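{- Let $D, N$ be positive integers, let $\alpha \in (0,1)$, and let $\delta \in (0,1)$ with $D\delta > 1$. Suppose that $\alpha^{ -1} < D \le (2-\delta)\alpha^{ -1}$ and $N \ge 2D^3/(D\delta - 1)$. Then \[ f_D(N,\alpha) = \frac{2(D\alpha - 1)}{D(D-1)} N + O(1), \] where the implied constant is absolute.
   Context: For a positive integer $N$, $[N] := \{1,2,\dots,N\}$. For a finite set $A$ of integers and an integer $d$, $r_{A-A}(d) := \#\{(a,a') \in A\times A : d = a - a'\}$. For $D > 1$, $M_D(A) := \max_{1 \le d < D} r_{A-A}(d)$. For positive integers $D \le N$ and $\alpha\in(0,1)$, $f_D(N,\alpha) := \min\{ M_D(A) : A \subseteq [N],\ |A| \ge \alpha N\}$.
   Formalization: The parameters α and δ take only rational values in (0,1). -}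

module Defs where

open import Data.Nat as ℕ using (ℕ; zero; suc; _⊔_; _⊓_; _∸_)
open import Data.Nat.Properties using (_≟_)
open import Data.Fin using (Fin; toℕ)
open import Data.Fin.Subset using (Subset; _∈_; ⊤; ∣_∣; inside; outside)
open import Data.Fin.Subset.Properties using (_∈?_)
open import Data.Vec using ([]; _∷_)
open import Data.List using (List; []; _∷_; map; filter; length; cartesianProduct; allFin; applyUpTo; foldr; _++_)
open import Data.Product using (_×_; _,_)
open import Relation.Nullary using (Dec; _×-dec_)
open import Relation.Binary.PropositionalEquality using (_≡_)
open import Data.Integer using (+_)
open import Data.Rational as ℚ using (ℚ; _/_)
import Data.Rational.Properties as ℚP

-- A subset A of [N] = {1,…,N} is represented as a 'Subset N' (subset of Fin N),
-- where the element i : Fin N stands for the integer toℕ i + 1.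
-- Differences a - a' are invariant under this shift.

toℚ : ℕ → ℚ
toℚ n = (+ n) / 1

-- 1/n as a rational (with the irrelevant convention 1/0 := 0)
recip : ℕ → ℚ
recip zero    = ℚ.0ℚ
recip (suc n) = (+ 1) / suc n

r : ∀ {N} → Subset N → ℕ → ℕ
r {N} A d = length (filter P? (cartesianProduct (allFin N) (allFin N)))
  where
  P? : (p : Fin N × Fin N) → Dec ((p .Data.Product.proj₁ ∈ A × p .Data.Product.proj₂ ∈ A) × toℕ (p .Data.Product.proj₁) ≡ toℕ (p .Data.Product.proj₂) ℕ.+ d)
  P? (a , a') = ((a ∈? A) ×-dec (a' ∈? A)) ×-dec (toℕ a ≟ toℕ a' ℕ.+ d)

-- M_D(A) = max_{1 ≤ d < D} r_{A-A}(d)   (the max over an empty range is 0)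
M : ℕ → ∀ {N} → Subset N → ℕ
M D A = foldr _⊔_ 0 (applyUpTo (λ i → r A (suc i)) (D ∸ 1))

allSubsets : ∀ N → List (Subset N)
allSubsets zero    = [] ∷ []
allSubsets (suc N) = map (inside ∷_) (allSubsets N) ++ map (outside ∷_) (allSubsets N)

-- The minimum is taken as a fold starting from M_D([N]); since the full set
-- [N] satisfies |[N]| = N ≥ α N whenever α ≤ 1, this is exactly the minimum
-- over the admissible family in the range α ∈ (0,1).
f : ℕ → ℕ → ℚ → ℕ
f D N α = foldr _⊓_ (M D (⊤ {N}))
  (map (M D) (filter (λ A → α ℚ.* toℚ N ℚP.≤? toℚ ∣ A ∣) (allSubsets N)))

module Submission where

-- Write X = 2Y, Y = (Dα - 1)N / (D(D-1)).
-- * Lower bound (LowerBound): scanning A ⊆ [N] from left to right, every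
--   new element gains weight D - (distance to its predecessor) in
--   W = ∑_{1≤d<D} (D-d) r_{A-A}(d); this yields D|A| ≤ W + N + (D-1), and
--   W ≤ M_D(A) D(D-1)/2.  For |A| ≥ αN this gives M_D(A) ≥ X - 1.
-- * Upper bound (BlockSet): for an integer s ∈ [Y+1, Y+2], a set made of
--   blocks of length D, each holding its first position and (for the first
--   (D-1)s blocks) one "mark" whose position moves one step every s blocks,
--   has M_D ≤ 2s and at least ⌊N/D⌋ + (D-1)s ≥ αN elements (this is where
--   Dα ≤ 2 - δ and the lower bound on N are used).

open import Data.Nat using (ℕ)
open import Data.Rational using (ℚ)

module Sums where

  open import Data.Nat using (ℕ; zero; suc; _+_; _*_; _≤_; _<_; z≤n)
  open import Data.Nat.Properties
  open import Data.Bool using (Bool; true; false; _∧_)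
  open import Data.Product using (_,_)
  open import Data.Sum using (inj₁; inj₂)
  open import Relation.Nullary using (Dec; yes; no; does; ¬_)
  open import Relation.Binary.PropositionalEquality
  open import Data.Empty using (⊥-elim)

  ∑ : ℕ → (ℕ → ℕ) → ℕ
  ∑ zero    f = 0
  ∑ (suc n) f = ∑ n f + f n

  ∑-front : ∀ n f → ∑ (suc n) f ≡ f 0 + ∑ n (λ j → f (suc j))
  ∑-front zero    f = +-comm 0 (f 0)
  ∑-front (suc n) f = begin
    ∑ (suc n) f + f (suc n)                  ≡⟨ cong (_+ f (suc n)) (∑-front n f) ⟩
    f 0 + ∑ n (λ j → f (suc j)) + f (suc n) ≡⟨ +-assoc (f 0) _ _ ⟩
    f 0 + (∑ n (λ j → f (suc j)) + f (suc n)) ∎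
    where open ≡-Reasoning

  ∑-cong : ∀ n {f g} → (∀ j → j < n → f j ≡ g j) → ∑ n f ≡ ∑ n g
  ∑-cong zero    eq = refl
  ∑-cong (suc n) eq = cong₂ _+_ (∑-cong n (λ j j<n → eq j (m<n⇒m<1+n j<n))) (eq n ≤-refl)

  ∑-mono : ∀ n {f g} → (∀ j → j < n → f j ≤ g j) → ∑ n f ≤ ∑ n g
  ∑-mono zero    le = z≤n
  ∑-mono (suc n) le = +-mono-≤ (∑-mono n (λ j j<n → le j (m<n⇒m<1+n j<n))) (le n ≤-refl)

  ∑-const : ∀ n c → ∑ n (λ _ → c) ≡ c * n
  ∑-const zero    c = sym (*-zeroʳ c)
  ∑-const (suc n) c = begin
    ∑ n (λ _ → c) + c ≡⟨ cong (_+ c) (∑-const n c) ⟩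
    c * n + c         ≡⟨ +-comm (c * n) c ⟩
    c + c * n         ≡⟨ *-suc c n ⟨
    c * suc n         ∎
    where open ≡-Reasoning

  ∑-zero : ∀ n {f} → (∀ j → j < n → f j ≡ 0) → ∑ n f ≡ 0
  ∑-zero n {f} eq = trans (∑-cong n {f} {λ _ → 0} eq) (∑-const n 0)

  ∑-+ : ∀ n f g → ∑ n (λ j → f j + g j) ≡ ∑ n f + ∑ n g
  ∑-+ zero    f g = refl
  ∑-+ (suc n) f g = begin
    ∑ n (λ j → f j + g j) + (f n + g n) ≡⟨ cong (_+ (f n + g n)) (∑-+ n f g) ⟩
    ∑ n f + ∑ n g + (f n + g n)         ≡⟨ +-assoc (∑ n f) _ _ ⟩
    ∑ n f + (∑ n g + (f n + g n))       ≡⟨ cong (∑ n f +_) (+-comm (∑ n g) _) ⟩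
    ∑ n f + ((f n + g n) + ∑ n g)       ≡⟨ cong (∑ n f +_) (+-assoc (f n) _ _) ⟩
    ∑ n f + (f n + (g n + ∑ n g))       ≡⟨ cong (λ z → ∑ n f + (f n + z)) (+-comm (g n) _) ⟩
    ∑ n f + (f n + (∑ n g + g n))       ≡⟨ +-assoc (∑ n f) _ _ ⟨
    ∑ n f + f n + (∑ n g + g n)         ∎
    where open ≡-Reasoning

  ∑-*ˡ : ∀ n c f → ∑ n (λ j → c * f j) ≡ c * ∑ n f
  ∑-*ˡ zero    c f = sym (*-zeroʳ c)
  ∑-*ˡ (suc n) c f = trans (cong (_+ c * f n) (∑-*ˡ n c f)) (sym (*-distribˡ-+ c (∑ n f) (f n)))

  ∑-split : ∀ m n f → ∑ (m + n) f ≡ ∑ m f + ∑ n (λ j → f (m + j))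
  ∑-split m zero    f = trans (cong (λ z → ∑ z f) (+-identityʳ m)) (sym (+-identityʳ _))
  ∑-split m (suc n) f = begin
    ∑ (m + suc n) f                          ≡⟨ cong (λ z → ∑ z f) (+-suc m n) ⟩
    ∑ (m + n) f + f (m + n)                  ≡⟨ cong (_+ f (m + n)) (∑-split m n f) ⟩
    ∑ m f + ∑ n (λ j → f (m + j)) + f (m + n) ≡⟨ +-assoc (∑ m f) _ _ ⟩
    ∑ m f + (∑ n (λ j → f (m + j)) + f (m + n)) ∎
    where open ≡-Reasoning

  ∑-blocks : ∀ n k f → ∑ (n * k) f ≡ ∑ n (λ q → ∑ k (λ ρ → f (q * k + ρ)))
  ∑-blocks zero    k f = refl
  ∑-blocks (suc n) k f = begin
    ∑ (k + n * k) f                          ≡⟨ cong (λ z → ∑ z f) (+-comm k (n * k)) ⟩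
    ∑ (n * k + k) f                          ≡⟨ ∑-split (n * k) k f ⟩
    ∑ (n * k) f + ∑ k (λ ρ → f (n * k + ρ)) ≡⟨ cong (_+ ∑ k (λ ρ → f (n * k + ρ))) (∑-blocks n k f) ⟩
    ∑ n (λ q → ∑ k (λ ρ → f (q * k + ρ))) + ∑ k (λ ρ → f (n * k + ρ)) ∎
    where open ≡-Reasoning

  ∑-prefix : ∀ m n f → m ≤ n → ∑ m f ≤ ∑ n f
  ∑-prefix m n f m≤n with m≤n⇒∃[o]m+o≡n m≤n
  ... | o , refl = begin
    ∑ m f                         ≤⟨ m≤m+n (∑ m f) _ ⟩
    ∑ m f + ∑ o (λ j → f (m + j)) ≡⟨ ∑-split m o f ⟨
    ∑ (m + o) f                   ∎
    where open ≤-Reasoning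

  ∑-term : ∀ n f k → k < n → f k ≤ ∑ n f
  ∑-term (suc n) f k k<1+n with m≤n⇒m<n∨m≡n (≤-pred k<1+n)
  ... | inj₁ k<n  = ≤-trans (∑-term n f k k<n) (m≤m+n _ _)
  ... | inj₂ refl = m≤n+m (f k) _

  indᵇ : Bool → ℕ
  indᵇ true  = 1
  indᵇ false = 0

  ind : ∀ {a} {P : Set a} → Dec P → ℕ
  ind p = indᵇ (does p)

  indᵇ-∧ : ∀ x y → indᵇ (x ∧ y) ≡ indᵇ x * indᵇ y
  indᵇ-∧ true  y = sym (+-identityʳ (indᵇ y))
  indᵇ-∧ false y = refl

  indᵇ≤1 : ∀ x → indᵇ x ≤ 1
  indᵇ≤1 true  = ≤-refl
  indᵇ≤1 false = z≤n

  ind-yes : ∀ {a} {P : Set a} → P → (p : Dec P) → ind p ≡ 1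
  ind-yes _ (yes _) = refl
  ind-yes p (no ¬p) = ⊥-elim (¬p p)

  ind-no : ∀ {a} {P : Set a} → ¬ P → (p : Dec P) → ind p ≡ 0
  ind-no ¬p (yes p) = ⊥-elim (¬p p)
  ind-no _  (no _)  = refl

  ind-iff : ∀ {a b} {P : Set a} {Q : Set b} → (P → Q) → (Q → P) →
            (p : Dec P) (q : Dec Q) → ind p ≡ ind q
  ind-iff f g (yes p) q = sym (ind-yes (f p) q)
  ind-iff f g (no ¬p) q = sym (ind-no (λ z → ¬p (g z)) q)

  off-diagonal : ∀ (h : ℕ → ℕ) {k} j → j ≢ k → h j * ind (j ≟ k) ≡ 0
  off-diagonal h {k} j j≢k = trans (cong (h j *_) (ind-no j≢k (j ≟ k))) (*-zeroʳ (h j))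

  ∑-pick : ∀ n (h : ℕ → ℕ) k → k < n → ∑ n (λ j → h j * ind (j ≟ k)) ≡ h k
  ∑-pick (suc n) h k k<1+n with m≤n⇒m<n∨m≡n (≤-pred k<1+n)
  ... | inj₁ k<n = begin
    ∑ n (λ j → h j * ind (j ≟ k)) + h n * ind (n ≟ k) ≡⟨ cong₂ _+_ (∑-pick n h k k<n) (off-diagonal h n (λ n≡k → <⇒≢ k<n (sym n≡k))) ⟩
    h k + 0                                              ≡⟨ +-identityʳ (h k) ⟩
    h k                                                  ∎
    where open ≡-Reasoning
  ... | inj₂ refl = begin
    ∑ n (λ j → h j * ind (j ≟ n)) + h n * ind (n ≟ n)
      ≡⟨ cong₂ _+_ (∑-zero n {λ j → h j * ind (j ≟ n)} (λ j j<n → off-diagonal h j (<⇒≢ j<n))) (cong (h n *_) (ind-yes refl (n ≟ n))) ⟩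
    0 + h n * 1                                          ≡⟨ *-identityʳ (h n) ⟩
    h n                                                  ∎
    where open ≡-Reasoning

  ∑-pick-≤ : ∀ n c k → ∑ n (λ i → c * ind (i ≟ k)) ≤ c
  ∑-pick-≤ n c k with k <? n
  ... | yes k<n = ≤-reflexive (∑-pick n (λ _ → c) k k<n)
  ... | no k≮n  = ≤-trans (≤-reflexive (∑-zero n (λ i i<n → off-diagonal (λ _ → c) i (λ i≡k → k≮n (subst (_< n) i≡k i<n))))) z≤n

  ∑-below : ∀ n K (g : ℕ → ℕ) → ∑ n (λ q → ind (q <? K) * g q) ≤ ∑ K g
  ∑-below n K g with n ≤? K
  ... | yes n≤K = ≤-trans (∑-mono n (λ q _ → ≤-trans (*-monoˡ-≤ (g q) (indᵇ≤1 (does (q <? K)))) (≤-reflexive (*-identityˡ (g q)))))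
                          (∑-prefix n K g n≤K)
  ... | no n≰K with m≤n⇒∃[o]m+o≡n (≤-trans (n≤1+n K) (≰⇒> n≰K))
  ...   | o , refl = begin
    ∑ (K + o) (λ q → ind (q <? K) * g q)
      ≡⟨ ∑-split K o _ ⟩
    ∑ K (λ q → ind (q <? K) * g q) + ∑ o (λ j → ind (K + j <? K) * g (K + j))
      ≡⟨ cong₂ _+_ (∑-cong K (λ q q<K → trans (cong (_* g q) (ind-yes q<K (q <? K))) (*-identityˡ (g q))))
                   (∑-zero o (λ j _ → cong (_* g (K + j)) (ind-no (λ lt → <-irrefl refl (≤-trans lt (m≤m+n K j))) (K + j <? K)))) ⟩
    ∑ K g + 0 ≡⟨ +-identityʳ _ ⟩
    ∑ K g     ∎
    where open ≤-Reasoning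

module Counting where

  open Sums
  open import Defs
  open import Data.Nat using (ℕ; zero; suc; _+_; _*_; _∸_; _≤_; _<_; z≤n; _⊔_; _⊓_)
  open import Data.Nat.Properties
  open import Data.Bool using (true; false; _∧_)
  open import Data.Fin as Fin using (Fin; toℕ)
  open import Data.Fin.Properties using (toℕ<n)
  open import Data.Fin.Subset using (Subset; ⊤; ∣_∣)
  open import Data.Fin.Subset.Properties using (_∈?_)
  open import Data.Vec using ([]; _∷_)
  open import Data.List using (List; []; _∷_; map; filter; length; cartesianProduct; allFin; foldr; _++_; tabulate)
  open import Data.List.Membership.Propositional using (_∈_)
  open import Data.List.Membership.Propositional.Properties using (∈-map⁺; ∈-map⁻; ∈-filter⁺; ∈-filter⁻; ∈-++⁺ˡ; ∈-++⁺ʳ; ∈-applyUpTo⁺; foldr-selective)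
  open import Data.List.Relation.Unary.Any using (here; there)
  open import Data.List.Relation.Unary.All.Properties using (applyUpTo⁺₁)
  open import Data.List.Properties using (foldr-preservesᵇ)
  open import Data.Product using (_×_; _,_; proj₂; ∃)
  import Data.Rational as ℚ
  import Data.Rational.Properties as ℚP
  open import Data.Sum using (_⊎_)
  import Data.Sum
  open import Relation.Nullary using (does; yes; no)
  open import Relation.Unary using (Decidable)
  open import Relation.Binary.PropositionalEquality

  ∑ₗ : ∀ {a} {A : Set a} → List A → (A → ℕ) → ℕ
  ∑ₗ []       h = 0
  ∑ₗ (x ∷ xs) h = h x + ∑ₗ xs h

  ∑ₗ-tabulate : ∀ {a} {A : Set a} N (t : Fin N → A) (h : A → ℕ) (g : ℕ → ℕ) →
                (∀ i → h (t i) ≡ g (toℕ i)) → ∑ₗ (tabulate t) h ≡ ∑ N g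
  ∑ₗ-tabulate zero    t h g eq = refl
  ∑ₗ-tabulate (suc N) t h g eq = begin
    h (t Fin.zero) + ∑ₗ (tabulate (λ i → t (Fin.suc i))) h
      ≡⟨ cong₂ _+_ (eq Fin.zero) (∑ₗ-tabulate N (λ i → t (Fin.suc i)) h (λ j → g (suc j)) (λ i → eq (Fin.suc i))) ⟩
    g 0 + ∑ N (λ j → g (suc j)) ≡⟨ ∑-front N g ⟨
    ∑ (suc N) g                 ∎
    where open ≡-Reasoning

  ∑ₗ-allFin : ∀ N (h : Fin N → ℕ) (g : ℕ → ℕ) → (∀ i → h i ≡ g (toℕ i)) → ∑ₗ (allFin N) h ≡ ∑ N g
  ∑ₗ-allFin N = ∑ₗ-tabulate N (λ i → i)

  length-filter-++ : ∀ {a b p} {A : Set a} {B : Set b} {P : B → Set p} (P? : Decidable P)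
    (t : A → B) (xs : List A) (ys : List B) →
    length (filter P? (map t xs ++ ys)) ≡ ∑ₗ xs (λ x → ind (P? (t x))) + length (filter P? ys)
  length-filter-++ P? t []       ys = refl
  length-filter-++ P? t (x ∷ xs) ys with does (P? (t x))
  ... | true  = cong suc (length-filter-++ P? t xs ys)
  ... | false = length-filter-++ P? t xs ys

  length-filter-× : ∀ {a b p} {A : Set a} {B : Set b} {P : A × B → Set p} (P? : Decidable P)
    (xs : List A) (ys : List B) →
    length (filter P? (cartesianProduct xs ys)) ≡ ∑ₗ xs (λ x → ∑ₗ ys (λ y → ind (P? (x , y))))
  length-filter-× P? []       ys = refl
  length-filter-× P? (x ∷ xs) ys = trans (length-filter-++ P? (x ,_) ys _) (cong (_ +_) (length-filter-× P? xs ys))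

  χ : ∀ {N} → Subset N → ℕ → ℕ
  χ []      n       = 0
  χ (b ∷ A) zero    = indᵇ b
  χ (b ∷ A) (suc n) = χ A n

  χ-∈ : ∀ {N} (A : Subset N) i → ind (i ∈? A) ≡ χ A (toℕ i)
  χ-∈ (true  ∷ A) Fin.zero    = refl
  χ-∈ (false ∷ A) Fin.zero    = refl
  χ-∈ (b     ∷ A) (Fin.suc i) = χ-∈ A i

  χ≤1 : ∀ {N} (A : Subset N) a → χ A a ≤ 1
  χ≤1 []      a       = z≤n
  χ≤1 (b ∷ A) zero    = indᵇ≤1 b
  χ≤1 (b ∷ A) (suc a) = χ≤1 A a

  shift : (ℕ → ℕ) → ℕ → ℕ → ℕ
  shift h zero    a       = h a
  shift h (suc d) zero    = 0
  shift h (suc d) (suc a) = shift h d a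

  shift-≥ : ∀ h d a → d ≤ a → shift h d a ≡ h (a ∸ d)
  shift-≥ h zero    a       _  = refl
  shift-≥ h (suc d) (suc a) le = shift-≥ h d a (≤-pred le)

  shift-< : ∀ h d a → a < d → shift h d a ≡ 0
  shift-< h (suc d) zero    _  = refl
  shift-< h (suc d) (suc a) lt = shift-< h d a (≤-pred lt)

  shift-cong : ∀ (h h' : ℕ → ℕ) d a → (∀ x → x ≤ a → h x ≡ h' x) → shift h d a ≡ shift h' d a
  shift-cong h h' zero    a       eq = eq a ≤-refl
  shift-cong h h' (suc d) zero    eq = refl
  shift-cong h h' (suc d) (suc a) eq = shift-cong h h' d a (λ x x≤a → eq x (m≤n⇒m≤1+n x≤a))

  ∑-at-distance : ∀ N (h : ℕ → ℕ) d a → a < N → ∑ N (λ j → h j * ind (a ≟ j + d)) ≡ shift h d a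
  ∑-at-distance N h d a a<N with d ≤? a
  ... | yes d≤a = begin
    ∑ N (λ j → h j * ind (a ≟ j + d))   ≡⟨ ∑-cong N (λ j _ → cong (h j *_) (ind-iff a≡j+d⇒j≡a∸d j≡a∸d⇒a≡j+d (a ≟ j + d) (j ≟ a ∸ d))) ⟩
    ∑ N (λ j → h j * ind (j ≟ a ∸ d))   ≡⟨ ∑-pick N h (a ∸ d) (≤-<-trans (m∸n≤m a d) a<N) ⟩
    h (a ∸ d)                           ≡⟨ shift-≥ h d a d≤a ⟨
    shift h d a                         ∎
    where
    open ≡-Reasoning
    a≡j+d⇒j≡a∸d : ∀ {j} → a ≡ j + d → j ≡ a ∸ d
    a≡j+d⇒j≡a∸d {j} eq = trans (sym (m+n∸n≡m j d)) (cong (_∸ d) (sym eq))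
    j≡a∸d⇒a≡j+d : ∀ {j} → j ≡ a ∸ d → a ≡ j + d
    j≡a∸d⇒a≡j+d eq = trans (sym (m∸n+n≡m d≤a)) (cong (_+ d) (sym eq))
  ... | no d≰a = begin
    ∑ N (λ j → h j * ind (a ≟ j + d))   ≡⟨ ∑-zero N {λ j → h j * ind (a ≟ j + d)} (λ j _ → trans (cong (h j *_) (ind-no (a≢j+d j) (a ≟ j + d))) (*-zeroʳ (h j))) ⟩
    0                                   ≡⟨ shift-< h d a (≰⇒> d≰a) ⟨
    shift h d a                         ∎
    where
    open ≡-Reasoning
    a≢j+d : ∀ j → a ≢ j + d
    a≢j+d j eq = d≰a (≤-trans (m≤n+m d j) (≤-reflexive (sym eq)))

  r-formula : ∀ {N} (A : Subset N) d → r A d ≡ ∑ N (λ a → χ A a * shift (χ A) d a)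
  r-formula {N} A d = trans (length-filter-× _ (allFin N) (allFin N))
    (∑ₗ-allFin N _ _ λ x → trans
       (∑ₗ-allFin N _ (λ j → χ A (toℕ x) * (χ A j * ind (toℕ x ≟ j + d))) (pair x))
       (trans (∑-*ˡ N (χ A (toℕ x)) _) (cong (χ A (toℕ x) *_) (∑-at-distance N (χ A) d (toℕ x) (toℕ<n x)))))
    where
    open ≡-Reasoning
    pair : ∀ x y → indᵇ ((does (x ∈? A) ∧ does (y ∈? A)) ∧ does (toℕ x ≟ toℕ y + d))
                  ≡ χ A (toℕ x) * (χ A (toℕ y) * ind (toℕ x ≟ toℕ y + d))
    pair x y = begin
      indᵇ ((does (x ∈? A) ∧ does (y ∈? A)) ∧ does (toℕ x ≟ toℕ y + d))
        ≡⟨ indᵇ-∧ (does (x ∈? A) ∧ does (y ∈? A)) _ ⟩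
      indᵇ (does (x ∈? A) ∧ does (y ∈? A)) * ind (toℕ x ≟ toℕ y + d)
        ≡⟨ cong (_* ind (toℕ x ≟ toℕ y + d)) (trans (indᵇ-∧ (does (x ∈? A)) _) (cong₂ _*_ (χ-∈ A x) (χ-∈ A y))) ⟩
      χ A (toℕ x) * χ A (toℕ y) * ind (toℕ x ≟ toℕ y + d)
        ≡⟨ *-assoc (χ A (toℕ x)) _ _ ⟩
      χ A (toℕ x) * (χ A (toℕ y) * ind (toℕ x ≟ toℕ y + d)) ∎

  card-formula : ∀ {N} (A : Subset N) → ∣ A ∣ ≡ ∑ N (χ A)
  card-formula []                   = refl
  card-formula {suc N} (true  ∷ A) = trans (cong suc (card-formula A)) (sym (∑-front N (χ (true ∷ A))))
  card-formula {suc N} (false ∷ A) = trans (card-formula A) (sym (∑-front N (χ (false ∷ A))))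

  M-≥ : ∀ D {N} (A : Subset N) i → i < D ∸ 1 → r A (suc i) ≤ M D A
  M-≥ D A i i<D-1 = ≤-foldr-⊔ (∈-applyUpTo⁺ (λ i → r A (suc i)) i<D-1)
    where
    ≤-foldr-⊔ : ∀ {x xs} → x ∈ xs → x ≤ foldr _⊔_ 0 xs
    ≤-foldr-⊔ (here refl) = m≤m⊔n _ _
    ≤-foldr-⊔ (there x∈)  = ≤-trans (≤-foldr-⊔ x∈) (m≤n⊔m _ _)

  M-≤ : ∀ D {N} (A : Subset N) B → (∀ i → i < D ∸ 1 → r A (suc i) ≤ B) → M D A ≤ B
  M-≤ D A B r≤B = foldr-preservesᵇ {P = _≤ B} ⊔-lub z≤n (applyUpTo⁺₁ _ (D ∸ 1) (λ {i} → r≤B i))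

  allSubsets-complete : ∀ {N} (A : Subset N) → A ∈ allSubsets N
  allSubsets-complete []                  = here refl
  allSubsets-complete {suc N} (true  ∷ A) = ∈-++⁺ˡ (∈-map⁺ (true ∷_) (allSubsets-complete A))
  allSubsets-complete {suc N} (false ∷ A) = ∈-++⁺ʳ (map (true ∷_) (allSubsets N)) (∈-map⁺ (false ∷_) (allSubsets-complete A))

  f-≤ : ∀ D N α (A : Subset N) → α ℚ.* toℚ N ℚ.≤ toℚ ∣ A ∣ → f D N α ≤ M D A
  f-≤ D N α A adm = foldr-⊓-≤ (∈-map⁺ (M D) (∈-filter⁺ (λ B → α ℚ.* toℚ N ℚP.≤? toℚ ∣ B ∣) (allSubsets-complete A) adm))
    where
    foldr-⊓-≤ : ∀ {e y ys} → y ∈ ys → foldr _⊓_ e ys ≤ y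
    foldr-⊓-≤ (here refl) = m⊓n≤m _ _
    foldr-⊓-≤ (there y∈)  = ≤-trans (m⊓n≤n _ _) (foldr-⊓-≤ y∈)

  f-attained : ∀ D N α → f D N α ≡ M D (⊤ {N}) ⊎ ∃ λ (A : Subset N) → α ℚ.* toℚ N ℚ.≤ toℚ ∣ A ∣ × f D N α ≡ M D A
  f-attained D N α = min-attained _ (M D) (M D (⊤ {N})) (allSubsets N)
    where
    min-attained : ∀ {a p} {X : Set a} {P : X → Set p} (P? : Decidable P) (g : X → ℕ) e xs →
                   let m = foldr _⊓_ e (map g (filter P? xs)) in m ≡ e ⊎ ∃ λ x → P x × m ≡ g x
    min-attained {P = P} P? g e xs = Data.Sum.map₂ in-image (foldr-selective ⊓-sel e (map g (filter P? xs)))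
      where
      in-image : ∀ {m} → m ∈ map g (filter P? xs) → ∃ λ x → P x × m ≡ g x
      in-image m∈ with ∈-map⁻ g {xs = filter P? xs} m∈
      ... | x , x∈ , m≡gx = x , proj₂ (∈-filter⁻ P? {xs = xs} x∈) , m≡gx

-- Writing W = ∑_{1≤d<D} (D-d) r_{A-A}(d), it follows from
-- D |A| ≤ W + N + (D-1) and W ≤ M_D(A) ∑_{1≤d<D} (D-d) = M_D(A) D(D-1)/2.
module LowerBound where

  open Sums
  open Counting
  open import Defs using (M)
  open import Data.Nat using (ℕ; zero; suc; _+_; _*_; _∸_; _≤_; _<_; z≤n; s≤s)
  open import Data.Nat.Properties
  open import Data.Nat.Tactic.RingSolver using (solve-∀)
  open import Data.Fin.Subset using (Subset; ∣_∣)
  open import Data.Product using (_×_; _,_; ∃)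
  open import Data.Sum using (inj₁; inj₂)
  open import Relation.Binary.PropositionalEquality

  module Scan (D : ℕ) (h : ℕ → ℕ) (h≤1 : ∀ a → h a ≤ 1) where

    pairs : ℕ → ℕ → ℕ
    pairs n d = ∑ n (λ a → h a * shift h d a)

    weighted : ℕ → ℕ
    weighted n = ∑ (D ∸ 1) (λ i → (D ∸ suc i) * pairs n (suc i))

    increment : ℕ → ℕ
    increment n = ∑ (D ∸ 1) (λ i → (D ∸ suc i) * (h n * shift h (suc i) n))

    weighted-step : ∀ n → weighted (suc n) ≡ weighted n + increment n
    weighted-step n = trans (∑-cong (D ∸ 1) (λ i _ → *-distribˡ-+ (D ∸ suc i) (pairs n (suc i)) _))
                            (∑-+ (D ∸ 1) _ _)

    -- recency n = max(0, D - (n - ℓ)) where ℓ < n is the last position with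
    -- h ℓ = 1: how much a new element at n gains from its nearest neighbour.
    recency : ℕ → ℕ
    recency zero    = 0
    recency (suc n) = step (h n) (recency n)
      where
      step : ℕ → ℕ → ℕ
      step zero    g = g ∸ 1
      step (suc _) g = D ∸ 1

    recency-absent : ∀ n → h n ≡ 0 → recency (suc n) ≡ recency n ∸ 1
    recency-absent n hn≡0 rewrite hn≡0 = refl

    recency-present : ∀ n → h n ≡ 1 → recency (suc n) ≡ D ∸ 1
    recency-present n hn≡1 rewrite hn≡1 = refl

    recency-≤ : ∀ n → recency n ≤ D ∸ 1
    recency-≤ zero = z≤n
    recency-≤ (suc n) with n≤1⇒n≡0∨n≡1 (h≤1 n)
    ... | inj₁ hn≡0 = ≤-trans (≤-reflexive (recency-absent n hn≡0)) (≤-trans (m∸n≤m (recency n) 1) (recency-≤ n))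
    ... | inj₂ hn≡1 = ≤-reflexive (recency-present n hn≡1)

    recency-witness : ∀ n → 0 < recency n →
      ∃ λ i → i < D ∸ 1 × D ∸ suc i ≡ recency n × shift h (suc i) n ≡ 1
    recency-witness (suc n) pos with n≤1⇒n≡0∨n≡1 (h≤1 n)
    ... | inj₂ hn≡1 = 0 , subst (0 <_) (recency-present n hn≡1) pos , sym (recency-present n hn≡1) , hn≡1
    ... | inj₁ hn≡0 with recency-witness n (≤-trans pos (≤-trans (≤-reflexive (recency-absent n hn≡0)) (m∸n≤m (recency n) 1)))
    ...   | i , _ , D-i-1≡rec , at-distance = suc i , i+1<D-1 , D-i-2≡rec , at-distance
      where
      D-i-2≡rec : D ∸ suc (suc i) ≡ recency (suc n)
      D-i-2≡rec = begin
        D ∸ suc (suc i)      ≡⟨ pred[m∸n]≡m∸[1+n] D (suc i) ⟨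
        (D ∸ suc i) ∸ 1      ≡⟨ cong (_∸ 1) D-i-1≡rec ⟩
        recency n ∸ 1        ≡⟨ recency-absent n hn≡0 ⟨
        recency (suc n)      ∎
        where open ≡-Reasoning
      i+1<D-1 : suc i < D ∸ 1
      i+1<D-1 = ∸-monoˡ-< (m∸n≢0⇒n<m {D} (λ eq → <⇒≢ pos (sym (trans (sym D-i-2≡rec) eq)))) (s≤s z≤n)

    -- A new element gains at least its recency, through its nearest neighbour.
    increment-≥ : ∀ n → h n ≡ 1 → recency n ≤ increment n
    increment-≥ n hn≡1 with recency n in rec≡
    ... | zero  = z≤n
    ... | suc g with recency-witness n (subst (0 <_) (sym rec≡) (s≤s z≤n))
    ...   | i , i<D-1 , D-i-1≡rec , at-distance = begin
      suc g                                    ≡⟨ trans D-i-1≡rec rec≡ ⟨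
      D ∸ suc i                                ≡⟨ *-identityʳ _ ⟨
      (D ∸ suc i) * (1 * 1)                    ≡⟨ cong (λ z → (D ∸ suc i) * z) (cong₂ _*_ hn≡1 at-distance) ⟨
      (D ∸ suc i) * (h n * shift h (suc i) n)  ≤⟨ ∑-term (D ∸ 1) (λ i → (D ∸ suc i) * (h n * shift h (suc i) n)) i i<D-1 ⟩
      increment n                              ∎
      where open ≤-Reasoning

    invariant : ∀ n → D * ∑ n h ≤ weighted n + n + recency n
    invariant zero = subst (_≤ weighted 0 + 0 + 0) (sym (*-zeroʳ D)) z≤n
    invariant (suc n) with n≤1⇒n≡0∨n≡1 (h≤1 n)
    ... | inj₁ hn≡0 = begin
      D * (∑ n h + h n)                       ≡⟨ cong (λ z → D * (∑ n h + z)) hn≡0 ⟩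
      D * (∑ n h + 0)                         ≡⟨ cong (D *_) (+-identityʳ _) ⟩
      D * ∑ n h                               ≤⟨ invariant n ⟩
      weighted n + n + recency n              ≤⟨ +-monoʳ-≤ (weighted n + n) (m≤n+m∸n (recency n) 1) ⟩
      weighted n + n + (1 + (recency n ∸ 1))  ≤⟨ ≤-reflexive (shuffle (weighted n) n (recency n ∸ 1)) ⟩
      weighted n + suc n + (recency n ∸ 1)    ≤⟨ +-monoˡ-≤ (recency n ∸ 1) (+-monoˡ-≤ (suc n) (m≤m+n (weighted n) (increment n))) ⟩
      weighted n + increment n + suc n + (recency n ∸ 1)
        ≡⟨ cong₂ (λ w z → w + suc n + z) (weighted-step n) (recency-absent n hn≡0) ⟨
      weighted (suc n) + suc n + recency (suc n) ∎
      where
      open ≤-Reasoning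
      shuffle : ∀ w n g → w + n + (1 + g) ≡ w + suc n + g
      shuffle = solve-∀
    ... | inj₂ hn≡1 = begin
      D * (∑ n h + h n)                                ≡⟨ cong (λ z → D * (∑ n h + z)) hn≡1 ⟩
      D * (∑ n h + 1)                                  ≡⟨ *-distribˡ-+ D (∑ n h) 1 ⟩
      D * ∑ n h + D * 1                                ≤⟨ +-mono-≤ (invariant n) (≤-reflexive (*-identityʳ D)) ⟩
      weighted n + n + recency n + D                   ≤⟨ +-monoˡ-≤ D (+-monoʳ-≤ (weighted n + n) (increment-≥ n hn≡1)) ⟩
      weighted n + n + increment n + D                 ≤⟨ +-monoʳ-≤ (weighted n + n + increment n) (m≤n+m∸n D 1) ⟩
      weighted n + n + increment n + (1 + (D ∸ 1))     ≡⟨ shuffle (weighted n) n (increment n) (D ∸ 1) ⟩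
      weighted n + increment n + suc n + (D ∸ 1)
        ≡⟨ cong₂ (λ w z → w + suc n + z) (weighted-step n) (recency-present n hn≡1) ⟨
      weighted (suc n) + suc n + recency (suc n)       ∎
      where
      open ≤-Reasoning
      shuffle : ∀ w n c g → w + n + c + (1 + g) ≡ w + c + suc n + g
      shuffle = solve-∀

  triangle : ∀ k → 2 * ∑ k (λ i → k ∸ i) ≡ k * suc k
  triangle zero    = refl
  triangle (suc k) = begin
    2 * ∑ (suc k) (λ i → suc k ∸ i)        ≡⟨ cong (2 *_) (∑-front k (λ i → suc k ∸ i)) ⟩
    2 * (suc k + ∑ k (λ i → k ∸ i))        ≡⟨ *-distribˡ-+ 2 (suc k) _ ⟩
    2 * suc k + 2 * ∑ k (λ i → k ∸ i)      ≡⟨ cong (2 * suc k +_) (triangle k) ⟩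
    2 * suc k + k * suc k                  ≡⟨ expand k ⟩
    suc k * suc (suc k)                    ∎
    where
    open ≡-Reasoning
    expand : ∀ k → 2 * suc k + k * suc k ≡ suc k * suc (suc k)
    expand = solve-∀

  lower-bound : ∀ D {N} (A : Subset N) → 2 * (D * ∣ A ∣) ≤ M D A * ((D ∸ 1) * D) + 2 * N + 2 * (D ∸ 1)
  lower-bound D {N} A = begin
    2 * (D * ∣ A ∣)                                  ≡⟨ cong (λ z → 2 * (D * z)) (card-formula A) ⟩
    2 * (D * ∑ N (χ A))                              ≤⟨ *-monoʳ-≤ 2 (≤-trans (invariant N) (+-monoʳ-≤ (weighted N + N) (recency-≤ N))) ⟩
    2 * (weighted N + N + (D ∸ 1))                   ≤⟨ *-monoʳ-≤ 2 (+-monoˡ-≤ (D ∸ 1) (+-monoˡ-≤ N weighted≤)) ⟩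
    2 * (μ * ∑ (D ∸ 1) (λ i → (D ∸ 1) ∸ i) + N + (D ∸ 1))
      ≡⟨ distribute μ (∑ (D ∸ 1) (λ i → (D ∸ 1) ∸ i)) N (D ∸ 1) ⟩
    μ * (2 * ∑ (D ∸ 1) (λ i → (D ∸ 1) ∸ i)) + 2 * N + 2 * (D ∸ 1)
      ≡⟨ cong (λ z → μ * z + 2 * N + 2 * (D ∸ 1)) (trans (triangle (D ∸ 1)) (D-1*D D)) ⟩
    μ * ((D ∸ 1) * D) + 2 * N + 2 * (D ∸ 1)          ∎
    where
    open ≤-Reasoning
    open Scan D (χ A) (χ≤1 A)
    μ : ℕ
    μ = M D A
    distribute : ∀ a b c d → 2 * (a * b + c + d) ≡ a * (2 * b) + 2 * c + 2 * d
    distribute = solve-∀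
    D-1*D : ∀ D → (D ∸ 1) * suc (D ∸ 1) ≡ (D ∸ 1) * D
    D-1*D zero    = refl
    D-1*D (suc D) = refl
    -- Each r_{A-A}(d), 1 ≤ d < D, is at most M_D(A).
    weighted≤ : weighted N ≤ μ * ∑ (D ∸ 1) (λ i → (D ∸ 1) ∸ i)
    weighted≤ = begin
      weighted N                               ≤⟨ ∑-mono (D ∸ 1) (λ i i<D-1 → *-monoʳ-≤ (D ∸ suc i)
                                                    (≤-trans (≤-reflexive (sym (r-formula A (suc i)))) (M-≥ D A i i<D-1))) ⟩
      ∑ (D ∸ 1) (λ i → (D ∸ suc i) * μ)        ≡⟨ ∑-cong (D ∸ 1) (λ i _ → trans (*-comm (D ∸ suc i) μ) (cong (μ *_) (sym (∸-+-assoc D 1 i)))) ⟩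
      ∑ (D ∸ 1) (λ i → μ * ((D ∸ 1) ∸ i))      ≡⟨ ∑-*ˡ (D ∸ 1) μ _ ⟩
      μ * ∑ (D ∸ 1) (λ i → (D ∸ 1) ∸ i)        ∎

-- Cut [N] into consecutive blocks of length
-- D = D₁ + 1 and, for a parameter s ≥ 1, put into A the first position of
-- every block q together with position 1 + ⌊q/s⌋ of block q when
-- q < K = D₁ s (its "mark").  For 1 ≤ d < D a pair (a, a-d) in A either has
-- a at the start of its block, and then a-d is the mark of the previous
-- block, at position D - d (at most s such blocks), or a is the mark of
-- its block, at position d (again at most s).  Hence M_D(A) ≤ 2s, while
-- |A| ≥ ⌊N/D⌋ + K as soon as K ≤ ⌊N/D⌋.
module BlockSet (D₁ s₁ : ℕ) where

  open Sums
  open Counting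
  open import Defs using (r; M)
  open import Data.Nat using (zero; suc; pred; _+_; _*_; _∸_; _≤_; _<_; z≤n; s≤s; _/_; _%_; NonZero)
  open import Data.Nat.Properties
  open import Data.Nat.DivMod
  open import Data.Nat.Divisibility using (divides-refl)
  open import Data.Nat.Tactic.RingSolver using (solve-∀)
  open import Data.Bool using (Bool; true; _∧_)
  open import Data.Fin using (toℕ)
  open import Data.Fin.Subset using (Subset; ∣_∣)
  open import Data.Vec using (tabulate)
  open import Data.Product using (_×_; _,_)
  open import Data.Sum using (_⊎_; inj₁; inj₂)
  import Data.Sum
  open import Relation.Nullary using (Dec; yes; no; does)
  open import Relation.Binary.PropositionalEquality
  open import Relation.Binary.Definitions using (tri<; tri≈; tri>)
  open import Data.Empty using (⊥-elim)

  D s K : ℕ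
  D = suc D₁
  s = suc s₁
  K = D₁ * s

  marked : ℕ → ℕ → Bool
  marked q zero    = true
  marked q (suc ρ) = does (q <? K) ∧ does (ρ ≟ q / s)

  member : ℕ → Bool
  member a = marked (a / D) (a % D)

  blockSet : ∀ N → Subset N
  blockSet N = tabulate (λ i → member (toℕ i))

  divmod-/ : ∀ q ρ n .{{_ : NonZero n}} → ρ < n → (q * n + ρ) / n ≡ q
  divmod-/ q ρ n ρ<n = trans (+-distrib-/-∣ˡ ρ (divides-refl q)) (trans (cong₂ _+_ (m*n/n≡m q n) (m<n⇒m/n≡0 ρ<n)) (+-identityʳ q))

  divmod-% : ∀ q ρ n .{{_ : NonZero n}} → ρ < n → (q * n + ρ) % n ≡ ρ
  divmod-% q ρ n ρ<n = trans (cong (_% n) (+-comm (q * n) ρ)) (trans ([m+kn]%n≡m%n ρ q n) (m<n⇒m%n≡m ρ<n))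

  member-block : ∀ q ρ → ρ < D → member (q * D + ρ) ≡ marked q ρ
  member-block q ρ ρ<D = cong₂ marked (divmod-/ q ρ D ρ<D) (divmod-% q ρ D ρ<D)

  χ-blockSet : ∀ N a → a < N → χ (blockSet N) a ≡ indᵇ (member a)
  χ-blockSet N a = χ-tabulate N member a
    where
    χ-tabulate : ∀ N (g : ℕ → Bool) a → a < N → χ (tabulate {n = N} (λ i → g (toℕ i))) a ≡ indᵇ (g a)
    χ-tabulate (suc N) g zero    _   = refl
    χ-tabulate (suc N) g (suc a) a<N = χ-tabulate N (λ x → g (suc x)) a (≤-pred a<N)

  markAt : ℕ → ℕ → ℕ
  markAt e q = ind (q <? K) * ind (suc (q / s) ≟ e)

  marked-suc : ∀ q ρ → indᵇ (marked q (suc ρ)) ≡ ind (q <? K) * ind (ρ ≟ q / s)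
  marked-suc q ρ = indᵇ-∧ (does (q <? K)) (does (ρ ≟ q / s))

  marked≡markAt : ∀ q e → 0 < e → indᵇ (marked q e) ≡ markAt e q
  marked≡markAt q (suc e) _ = trans (marked-suc q e)
    (cong (ind (q <? K) *_) (ind-iff (λ eq → cong suc (sym eq)) (λ eq → sym (suc-injective eq)) (e ≟ q / s) (suc (q / s) ≟ suc e)))

  marked-cases : ∀ q ρ → indᵇ (marked q (suc ρ)) ≡ 0 ⊎ (q < K × ρ ≡ q / s)
  marked-cases q ρ = Data.Sum.map₁ (trans (marked-suc q ρ)) (cases (q <? K) (ρ ≟ q / s))
    where
    cases : (p : Dec (q < K)) (e : Dec (ρ ≡ q / s)) → ind p * ind e ≡ 0 ⊎ (q < K × ρ ≡ q / s)
    cases (yes q<K) (yes ρ≡) = inj₂ (q<K , ρ≡)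
    cases (yes _)   (no _)   = inj₁ refl
    cases (no _)    _        = inj₁ refl

  unmarked : ∀ q ρ → ρ ≢ q / s → indᵇ (marked q (suc ρ)) ≡ 0
  unmarked q ρ ρ≢ with marked-cases q ρ
  ... | inj₁ eq       = eq
  ... | inj₂ (_ , ρ≡) = ⊥-elim (ρ≢ ρ≡)

  inA : ℕ → ℕ
  inA a = indᵇ (member a)

  module Distance (d : ℕ) (0<d : 0 < d) (d<D : d < D) where

    T : ℕ → ℕ
    T a = inA a * shift inA d a

    T≤inA : ∀ a → T a ≤ inA a
    T≤inA a = ≤-trans (*-monoʳ-≤ (inA a) (χ≤1-shift a)) (≤-reflexive (*-identityʳ (inA a)))
      where
      χ≤1-shift : ∀ a → shift inA d a ≤ 1
      χ≤1-shift a with d ≤? a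
      ... | yes d≤a = subst (_≤ 1) (sym (shift-≥ inA d a d≤a)) (indᵇ≤1 (member (a ∸ d)))
      ... | no d≰a  = subst (_≤ 1) (sym (shift-< inA d a (≰⇒> d≰a))) z≤n

    T≤shift : ∀ a → T a ≤ shift inA d a
    T≤shift a = ≤-trans (*-monoˡ-≤ (shift inA d a) (indᵇ≤1 (member a))) (≤-reflexive (*-identityˡ _))

    shift-same-block : ∀ q ρ → ρ < D → d ≤ ρ → shift inA d (q * D + ρ) ≡ indᵇ (marked q (ρ ∸ d))
    shift-same-block q ρ ρ<D d≤ρ = begin
      shift inA d (q * D + ρ)   ≡⟨ shift-≥ inA d (q * D + ρ) (≤-trans d≤ρ (m≤n+m ρ (q * D))) ⟩
      inA (q * D + ρ ∸ d)       ≡⟨ cong inA (+-∸-assoc (q * D) d≤ρ) ⟩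
      inA (q * D + (ρ ∸ d))     ≡⟨ cong indᵇ (member-block q (ρ ∸ d) (≤-<-trans (m∸n≤m ρ d) ρ<D)) ⟩
      indᵇ (marked q (ρ ∸ d))   ∎
      where open ≡-Reasoning

    shift-previous-block : ∀ q ρ → ρ < d → shift inA d (suc q * D + ρ) ≡ indᵇ (marked q (D + ρ ∸ d))
    shift-previous-block q ρ ρ<d = begin
      shift inA d (suc q * D + ρ)   ≡⟨ shift-≥ inA d (suc q * D + ρ) d≤a ⟩
      inA (suc q * D + ρ ∸ d)       ≡⟨ cong (λ z → inA (z ∸ d)) (regroup q ρ D) ⟩
      inA (q * D + (D + ρ) ∸ d)     ≡⟨ cong inA (+-∸-assoc (q * D) (≤-trans (<⇒≤ d<D) (m≤m+n D ρ))) ⟩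
      inA (q * D + (D + ρ ∸ d))     ≡⟨ cong indᵇ (member-block q (D + ρ ∸ d) D+ρ-d<D) ⟩
      indᵇ (marked q (D + ρ ∸ d))   ∎
      where
      open ≡-Reasoning
      regroup : ∀ q ρ D → (D + q * D) + ρ ≡ q * D + (D + ρ)
      regroup = solve-∀
      d≤a : d ≤ suc q * D + ρ
      d≤a = ≤-trans (<⇒≤ d<D) (≤-trans (m≤m+n D (q * D)) (m≤m+n (D + q * D) ρ))
      D+ρ-d<D : D + ρ ∸ d < D
      D+ρ-d<D = subst (λ z → D + ρ ∸ d < z) (m∸n+n≡m (<⇒≤ d<D))
                  (subst (_< (D ∸ d) + d) (sym (+-∸-comm ρ (<⇒≤ d<D))) (+-monoʳ-< (D ∸ d) ρ<d))

    -- Pairs whose larger element starts block q pair with the mark of block q-1.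
    cross : ℕ → ℕ
    cross zero    = 0
    cross (suc q) = markAt (D ∸ d) q

    T-start : ∀ q → T (q * D + 0) ≤ cross q
    T-start zero    = ≤-trans (T≤shift 0) (≤-reflexive (shift-< inA d 0 0<d))
    T-start (suc q) = begin
      T (suc q * D + 0)                   ≤⟨ T≤shift (suc q * D + 0) ⟩
      shift inA d (suc q * D + 0)         ≡⟨ shift-previous-block q 0 0<d ⟩
      indᵇ (marked q (D + 0 ∸ d))         ≡⟨ cong (λ z → indᵇ (marked q (z ∸ d))) (+-identityʳ D) ⟩
      indᵇ (marked q (D ∸ d))             ≡⟨ marked≡markAt q (D ∸ d) (m<n⇒0<n∸m d<D) ⟩
      markAt (D ∸ d) q                    ∎
      where open ≤-Reasoning

    T-at-d : ∀ q → T (q * D + d) ≤ markAt d q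
    T-at-d q = ≤-trans (T≤inA (q * D + d))
                 (≤-reflexive (trans (cong indᵇ (member-block q d d<D)) (marked≡markAt q d 0<d)))

    T-same-block : ∀ q ρ → ρ ≡ q / s → d < suc ρ → suc ρ < D → T (q * D + suc ρ) ≡ 0
    T-same-block q ρ ρ≡ d<1+ρ 1+ρ<D = n≤0⇒n≡0 (begin
      T (q * D + suc ρ)                   ≤⟨ T≤shift (q * D + suc ρ) ⟩
      shift inA d (q * D + suc ρ)         ≡⟨ shift-same-block q (suc ρ) 1+ρ<D (<⇒≤ d<1+ρ) ⟩
      indᵇ (marked q (suc ρ ∸ d))         ≡⟨ cong (λ z → indᵇ (marked q z)) (+-∸-assoc 1 d≤ρ) ⟩
      indᵇ (marked q (suc (ρ ∸ d)))       ≡⟨ unmarked q (ρ ∸ d) (λ eq → <-irrefl (trans eq (sym ρ≡)) (∸-monoʳ-< 0<d d≤ρ)) ⟩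
      0                                   ∎)
      where
      open ≤-Reasoning
      d≤ρ : d ≤ ρ
      d≤ρ = ≤-pred d<1+ρ

    T-cross : ∀ q ρ → ρ ≡ q / s → suc ρ < d → T (q * D + suc ρ) ≡ 0
    T-cross zero    ρ _  1+ρ<d = n≤0⇒n≡0 (≤-trans (T≤shift (suc ρ)) (≤-reflexive (shift-< inA d (suc ρ) 1+ρ<d)))
    T-cross (suc q) ρ ρ≡ 1+ρ<d = n≤0⇒n≡0 (begin
      T (suc q * D + suc ρ)               ≤⟨ T≤shift (suc q * D + suc ρ) ⟩
      shift inA d (suc q * D + suc ρ)     ≡⟨ shift-previous-block q (suc ρ) 1+ρ<d ⟩
      indᵇ (marked q (D + suc ρ ∸ d))     ≡⟨ cong (λ z → indᵇ (marked q z)) D+1+ρ-d ⟩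
      indᵇ (marked q (suc (D + ρ ∸ d)))   ≡⟨ unmarked q (D + ρ ∸ d) (λ eq → <-irrefl refl (≤-<-trans (subst (_≤ ρ) (sym eq) q/s≤ρ) ρ<D+ρ-d)) ⟩
      0                                   ∎)
      where
      open ≤-Reasoning
      D+1+ρ-d : D + suc ρ ∸ d ≡ suc (D + ρ ∸ d)
      D+1+ρ-d = trans (cong (_∸ d) (+-suc D ρ)) (+-∸-assoc 1 (≤-trans (<⇒≤ d<D) (m≤m+n D ρ)))
      ρ<D+ρ-d : ρ < D + ρ ∸ d
      ρ<D+ρ-d = subst (_< D + ρ ∸ d) (m+n∸m≡n d ρ)
                  (∸-monoˡ-< (subst (d + ρ <_) (+-comm ρ D) (subst (_< ρ + D) (+-comm ρ d) (+-monoʳ-< ρ d<D))) (m≤m+n d ρ))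
      q/s≤ρ : q / s ≤ ρ
      q/s≤ρ = subst (q / s ≤_) (sym ρ≡) (/-monoˡ-≤ s (n≤1+n q))

    T-block : ∀ q ρ → ρ < D → T (q * D + ρ) ≤ cross q * ind (ρ ≟ 0) + markAt d q * ind (ρ ≟ d)
    T-block q zero _ = ≤-trans (T-start q) (≤-trans (≤-reflexive (sym (*-identityʳ (cross q)))) (m≤m+n _ _))
    T-block q (suc ρ) 1+ρ<D with marked-cases q ρ
    ... | inj₁ unm = ≤-trans (T≤inA (q * D + suc ρ)) (≤-trans (≤-reflexive (trans (cong indᵇ (member-block q (suc ρ) 1+ρ<D)) unm)) z≤n)
    ... | inj₂ (_ , ρ≡) with <-cmp (suc ρ) d
    ...   | tri< 1+ρ<d _ _ = ≤-trans (≤-reflexive (T-cross q ρ ρ≡ 1+ρ<d)) z≤n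
    ...   | tri> _ _ d<1+ρ = ≤-trans (≤-reflexive (T-same-block q ρ ρ≡ d<1+ρ 1+ρ<D)) z≤n
    ...   | tri≈ _ refl _  = begin
      T (q * D + d)                                           ≤⟨ T-at-d q ⟩
      markAt d q                                              ≡⟨ *-identityʳ _ ⟨
      markAt d q * 1                                          ≡⟨ cong (markAt d q *_) (ind-yes refl (d ≟ d)) ⟨
      markAt d q * ind (d ≟ d)                                ≤⟨ m≤n+m _ _ ⟩
      cross q * ind (d ≟ 0) + markAt d q * ind (d ≟ d)        ∎
      where open ≤-Reasoning

  -- Only the blocks q < K carry a mark, s of them at each position.
  ∑-markAt : ∀ e n → ∑ n (markAt e) ≤ s
  ∑-markAt e n = begin
    ∑ n (markAt e)                                             ≤⟨ ∑-below n K (λ q → ind (suc (q / s) ≟ e)) ⟩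
    ∑ (D₁ * s) (λ q → ind (suc (q / s) ≟ e))                   ≡⟨ ∑-blocks D₁ s _ ⟩
    ∑ D₁ (λ i → ∑ s (λ j → ind (suc ((i * s + j) / s) ≟ e)))   ≡⟨ ∑-cong D₁ (λ i _ → trans (∑-cong s (λ j j<s → cong (λ z → ind (suc z ≟ e)) (divmod-/ i j s j<s))) (∑-const s _)) ⟩
    ∑ D₁ (λ i → ind (suc i ≟ e) * s)                           ≤⟨ ∑-mono D₁ (λ i _ → ≤-trans (≤-reflexive (*-comm (ind (suc i ≟ e)) s)) (*-monoʳ-≤ s (ind-suc≤ i e))) ⟩
    ∑ D₁ (λ i → s * ind (i ≟ pred e))                          ≤⟨ ∑-pick-≤ D₁ s (pred e) ⟩
    s                                                          ∎
    where
    open ≤-Reasoning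
    ind-suc≤ : ∀ i e → ind (suc i ≟ e) ≤ ind (i ≟ pred e)
    ind-suc≤ i zero    = z≤n
    ind-suc≤ i (suc e) = ≤-refl

  N<blocks : ∀ N → N < suc (N / D) * D
  N<blocks N = begin-strict
    N                     ≡⟨ m≡m%n+[m/n]*n N D ⟩
    N % D + (N / D) * D   <⟨ +-monoˡ-< ((N / D) * D) (m%n<n N D) ⟩
    D + (N / D) * D       ∎
    where open ≤-Reasoning

  r-bound : ∀ N i → i < D₁ → r (blockSet N) (suc i) ≤ s + s
  r-bound N i i<D₁ = begin
    r (blockSet N) d                                   ≡⟨ r-formula (blockSet N) d ⟩
    ∑ N (λ a → χ (blockSet N) a * shift (χ (blockSet N)) d a)
      ≡⟨ ∑-cong N (λ a a<N → cong₂ _*_ (χ-blockSet N a a<N) (shift-cong _ _ d a (λ x x≤a → χ-blockSet N x (≤-<-trans x≤a a<N)))) ⟩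
    ∑ N T                                              ≤⟨ ∑-prefix N (suc m * D) T (<⇒≤ (N<blocks N)) ⟩
    ∑ (suc m * D) T                                    ≡⟨ ∑-blocks (suc m) D T ⟩
    ∑ (suc m) (λ q → ∑ D (λ ρ → T (q * D + ρ)))        ≤⟨ ∑-mono (suc m) (λ q _ → ∑-mono D (λ ρ ρ<D → T-block q ρ ρ<D)) ⟩
    ∑ (suc m) (λ q → ∑ D (λ ρ → cross q * ind (ρ ≟ 0) + markAt d q * ind (ρ ≟ d)))
      ≡⟨ ∑-cong (suc m) (λ q _ → trans (∑-+ D _ _) (cong₂ _+_ (∑-pick D (λ _ → cross q) 0 (s≤s z≤n)) (∑-pick D (λ _ → markAt d q) d (s≤s i<D₁)))) ⟩
    ∑ (suc m) (λ q → cross q + markAt d q)             ≡⟨ ∑-+ (suc m) cross (markAt d) ⟩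
    ∑ (suc m) cross + ∑ (suc m) (markAt d)             ≤⟨ +-mono-≤ (≤-trans (≤-reflexive (∑-front m cross)) (∑-markAt (D ∸ d) m)) (∑-markAt d (suc m)) ⟩
    s + s                                              ∎
    where
    open ≤-Reasoning
    d m : ℕ
    d = suc i
    m = N / D
    open Distance d (s≤s z≤n) (s≤s i<D₁)

  M-bound : ∀ N → M D (blockSet N) ≤ s + s
  M-bound N = M-≤ D (blockSet N) (s + s) (r-bound N)

  block-size : ∀ q → 1 + ind (q <? K) ≤ ∑ D (λ ρ → indᵇ (marked q ρ))
  block-size q = subst (1 + ind (q <? K) ≤_) (sym (∑-front D₁ (λ ρ → indᵇ (marked q ρ)))) (s≤s (mark q (q <? K)))
    where
    mark : ∀ q (q<?K : Dec (q < K)) → ind q<?K ≤ ∑ D₁ (λ ρ → indᵇ (marked q (suc ρ)))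
    mark q (no _)    = z≤n
    mark q (yes q<K) = begin
      1                               ≡⟨ cong₂ _*_ (ind-yes q<K (q <? K)) (ind-yes refl (q / s ≟ q / s)) ⟨
      ind (q <? K) * ind (q / s ≟ q / s)   ≡⟨ marked-suc q (q / s) ⟨
      indᵇ (marked q (suc (q / s)))   ≤⟨ ∑-term D₁ (λ ρ → indᵇ (marked q (suc ρ))) (q / s) (m<n*o⇒m/o<n q<K) ⟩
      ∑ D₁ (λ ρ → indᵇ (marked q (suc ρ))) ∎
      where open ≤-Reasoning

  card-bound : ∀ N → K ≤ N / D → N / D + K ≤ ∣ blockSet N ∣
  card-bound N K≤m = begin
    m + K                                          ≡⟨ cong (m +_) (trans (∑-cong K (λ q q<K → ind-yes q<K (q <? K))) (trans (∑-const K 1) (*-identityˡ K))) ⟨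
    m + ∑ K (λ q → ind (q <? K))                   ≤⟨ +-monoʳ-≤ m (∑-prefix K m _ K≤m) ⟩
    m + ∑ m (λ q → ind (q <? K))                   ≡⟨ cong (_+ ∑ m (λ q → ind (q <? K))) (trans (∑-const m 1) (*-identityˡ m)) ⟨
    ∑ m (λ _ → 1) + ∑ m (λ q → ind (q <? K))       ≡⟨ ∑-+ m _ _ ⟨
    ∑ m (λ q → 1 + ind (q <? K))                   ≤⟨ ∑-mono m (λ q _ → block-size q) ⟩
    ∑ m (λ q → ∑ D (λ ρ → indᵇ (marked q ρ)))      ≡⟨ ∑-cong m (λ q _ → ∑-cong D (λ ρ ρ<D → cong indᵇ (member-block q ρ ρ<D))) ⟨
    ∑ m (λ q → ∑ D (λ ρ → inA (q * D + ρ)))        ≡⟨ ∑-blocks m D inA ⟨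
    ∑ (m * D) inA                                  ≤⟨ ∑-prefix (m * D) N inA (m/n*n≤m N D) ⟩
    ∑ N inA                                        ≡⟨ ∑-cong N (χ-blockSet N) ⟨
    ∑ N (χ (blockSet N))                           ≡⟨ card-formula (blockSet N) ⟨
    ∣ blockSet N ∣                                 ∎
    where
    open ≤-Reasoning
    m : ℕ
    m = N / D

-- Throughout, D is written 1 + d₁ with d₁ = D - 1 ≥ 1, and R stands for
-- 1/(D(D-1)), used only through (1 + d₁) d₁ R = 1.
module RationalArithmetic where

  open import Defs using (toℚ; recip)
  open import Data.Nat as ℕ using (ℕ; zero; suc)
  open import Data.Integer as ℤ using (+_)
  import Data.Integer.Properties as ℤP
  open import Data.Rational as ℚ using (ℚ; mkℚ; 0ℚ; 1ℚ; _<_; _≤_; _+_; _*_; _-_; -_; ∣_∣)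
  open import Data.Rational.Properties
  open import Data.Rational.Solver using (module +-*-Solver)
  open +-*-Solver
  import Data.Nat.Coprimality as Coprime
  open import Relation.Binary.PropositionalEquality
  open import Relation.Nullary using (¬_; yes; no)
  open import Data.Product using (_×_; _,_; ∃)
  open import Data.Sum using (inj₁; inj₂)
  open import Data.Empty using (⊥-elim)

  toℚ-mkℚ : ∀ n → toℚ n ≡ mkℚ (+ n) 0 (Coprime.sym (Coprime.1-coprimeTo n))
  toℚ-mkℚ n = ↥p/↧p≡p (mkℚ (+ n) 0 (Coprime.sym (Coprime.1-coprimeTo n)))

  toℚ-+ : ∀ m n → toℚ (m ℕ.+ n) ≡ toℚ m + toℚ n
  toℚ-+ m n rewrite toℚ-mkℚ m | toℚ-mkℚ n =
    trans (toℚ-mkℚ (m ℕ.+ n)) (sym (trans (/-cong {p₂ = + (m ℕ.+ n)} eq refl) (toℚ-mkℚ (m ℕ.+ n))))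
    where
    eq : + m ℤ.* + 1 ℤ.+ + n ℤ.* + 1 ≡ + (m ℕ.+ n)
    eq = trans (cong₂ ℤ._+_ (ℤP.*-identityʳ (+ m)) (ℤP.*-identityʳ (+ n))) (sym (ℤP.pos-+ m n))

  toℚ-* : ∀ m n → toℚ (m ℕ.* n) ≡ toℚ m * toℚ n
  toℚ-* m n rewrite toℚ-mkℚ m | toℚ-mkℚ n =
    trans (toℚ-mkℚ (m ℕ.* n)) (sym (trans (/-cong {p₂ = + (m ℕ.* n)} (sym (ℤP.pos-* m n)) refl) (toℚ-mkℚ (m ℕ.* n))))

  toℚ-mono-≤ : ∀ {m n} → m ℕ.≤ n → toℚ m ≤ toℚ n
  toℚ-mono-≤ {m} {n} le rewrite toℚ-mkℚ m | toℚ-mkℚ n = ℚ.*≤* (ℤP.*-monoʳ-≤-nonNeg (+ 1) (ℤ.+≤+ le))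

  toℚ-cancel-< : ∀ {m n} → toℚ m < toℚ n → m ℕ.< n
  toℚ-cancel-< {m} {n} lt rewrite toℚ-mkℚ m | toℚ-mkℚ n with lt
  ... | ℚ.*<* p = ℤP.drop‿+<+ (subst₂ ℤ._<_ (ℤP.*-identityʳ (+ m)) (ℤP.*-identityʳ (+ n)) p)

  recip-inverse : ∀ n .{{_ : ℕ.NonZero n}} → toℚ n * recip n ≡ 1ℚ
  recip-inverse (suc n) rewrite toℚ-mkℚ (suc n) | ↥p/↧p≡p (mkℚ (+ 1) n (Coprime.1-coprimeTo (suc n))) =
    *-inverseʳ (mkℚ (+ suc n) 0 (Coprime.sym (Coprime.1-coprimeTo (suc n))))

  recip-nonNeg : ∀ n → 0ℚ ≤ recip n
  recip-nonNeg zero    = ≤-refl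
  recip-nonNeg (suc n) = subst (0ℚ ≤_) (sym (↥p/↧p≡p r)) (nonNegative⁻¹ r)
    where
    r : ℚ
    r = mkℚ (+ 1) n (Coprime.1-coprimeTo (suc n))

  -- Elementary order facts: inequalities are reduced to nonnegativity of
  -- a difference, established as an explicit sum of nonnegative terms.
  two : ℚ
  two = 1ℚ + 1ℚ

  0≤1 : 0ℚ ≤ 1ℚ
  0≤1 = toℚ-mono-≤ {0} {1} ℕ.z≤n

  0<1 : 0ℚ < 1ℚ
  0<1 = ℚ.*<* (ℤ.+<+ (ℕ.s≤s ℕ.z≤n))

  0≤+ : ∀ {a b} → 0ℚ ≤ a → 0ℚ ≤ b → 0ℚ ≤ a + b
  0≤+ = +-mono-≤

  0≤* : ∀ {a b} → 0ℚ ≤ a → 0ℚ ≤ b → 0ℚ ≤ a * b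
  0≤* {a} {b} 0≤a 0≤b = subst (_≤ a * b) (*-zeroˡ b) (*-monoʳ-≤-nonNeg b {{ℚ.nonNegative 0≤b}} 0≤a)

  0≤two : 0ℚ ≤ two
  0≤two = 0≤+ 0≤1 0≤1

  0≤q-p : ∀ {p q} → p ≤ q → 0ℚ ≤ q - p
  0≤q-p {p} {q} p≤q = subst (_≤ q - p) (+-inverseʳ p) (+-monoˡ-≤ (- p) p≤q)

  0≤q-p⇒p≤q : ∀ {p q} → 0ℚ ≤ q - p → p ≤ q
  0≤q-p⇒p≤q {p} {q} 0≤q-p = subst₂ _≤_ (+-identityˡ p) (solve 2 (λ p q → q :- p :+ p := q) refl p q) (+-monoˡ-≤ p 0≤q-p)

  0<q-p⇒p<q : ∀ {p q} → 0ℚ < q - p → p < q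
  0<q-p⇒p<q {p} {q} 0<q-p = subst₂ _<_ (+-identityˡ p) (solve 2 (λ p q → q :- p :+ p := q) refl p q) (+-monoˡ-< p 0<q-p)

  cancel-pos-≤ : ∀ {c t} → 0ℚ < c → 0ℚ ≤ c * t → 0ℚ ≤ t
  cancel-pos-≤ {c} {t} 0<c h = *-cancelˡ-≤-pos c {{ℚ.positive 0<c}} (subst (_≤ c * t) (sym (*-zeroʳ c)) h)

  cancel-pos-< : ∀ {c t} → 0ℚ < c → 0ℚ < c * t → 0ℚ < t
  cancel-pos-< {c} {t} 0<c h = *-cancelˡ-<-nonNeg c {{ℚ.nonNegative (<⇒≤ 0<c)}} (subst (_< c * t) (sym (*-zeroʳ c)) h)

  1+d₁-pos : ∀ {d₁} → 1ℚ ≤ d₁ → 0ℚ < 1ℚ + d₁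
  1+d₁-pos {d₁} 1≤d₁ = subst (_< 1ℚ + d₁) (+-identityʳ 0ℚ) (+-mono-<-≤ 0<1 (≤-trans 0≤1 1≤d₁))

  -- A polynomial identity in which z stands for D(D-1)R, specialised at z = 1.
  at-ER≡1 : ∀ {S T z} (G : ℚ → ℚ) → S ≡ G z → z ≡ 1ℚ → G 1ℚ ≡ T → S ≡ T
  at-ER≡1 G S≡Gz refl G1≡T = trans S≡Gz G1≡T

  -- Lower bound: for an admissible A (αN ≤ |A| = c) with M_D(A) = μ, the
  -- counting inequality 2Dc ≤ μ D(D-1) + 2N + 2(D-1) gives μ ≥ X - 1.
  lower-estimate : ∀ d₁ α n R c μ → 0ℚ ≤ R → 1ℚ ≤ d₁ → (1ℚ + d₁) * d₁ * R ≡ 1ℚ →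
    α * n ≤ c →
    two * ((1ℚ + d₁) * c) ≤ μ * (d₁ * (1ℚ + d₁)) + two * n + two * d₁ →
    two * ((1ℚ + d₁) * α - 1ℚ) * n * R - 1ℚ ≤ μ
  lower-estimate d₁ α n R c μ 0≤R 1≤d₁ ER αn≤c counting = 0≤q-p⇒p≤q (subst (0ℚ ≤_) eq nonNeg)
    where
    0≤d₁ : 0ℚ ≤ d₁
    0≤d₁ = ≤-trans 0≤1 1≤d₁
    X : ℚ
    X = two * ((1ℚ + d₁) * α - 1ℚ) * n * R
    nonNeg : 0ℚ ≤ (μ * (d₁ * (1ℚ + d₁)) + two * n + two * d₁ - two * ((1ℚ + d₁) * c)) * R
                   + two * (1ℚ + d₁) * R * (c - α * n) + d₁ * (d₁ - 1ℚ) * R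
    nonNeg = 0≤+ (0≤+ (0≤* (0≤q-p counting) 0≤R) (0≤* (0≤* (0≤* 0≤two (0≤+ 0≤1 0≤d₁)) 0≤R) (0≤q-p αn≤c)))
                 (0≤* (0≤* 0≤d₁ (0≤q-p 1≤d₁)) 0≤R)
    eq : (μ * (d₁ * (1ℚ + d₁)) + two * n + two * d₁ - two * ((1ℚ + d₁) * c)) * R
           + two * (1ℚ + d₁) * R * (c - α * n) + d₁ * (d₁ - 1ℚ) * R
         ≡ μ - (X - 1ℚ)
    eq = at-ER≡1 (λ z → μ * z - (X - z))
      (solve 6 (λ d₁ α n R c μ →
          (μ :* (d₁ :* (con 1ℚ :+ d₁)) :+ (con 1ℚ :+ con 1ℚ) :* n :+ (con 1ℚ :+ con 1ℚ) :* d₁ :- (con 1ℚ :+ con 1ℚ) :* ((con 1ℚ :+ d₁) :* c)) :* R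
          :+ (con 1ℚ :+ con 1ℚ) :* (con 1ℚ :+ d₁) :* R :* (c :- α :* n) :+ d₁ :* (d₁ :- con 1ℚ) :* R
          := μ :* ((con 1ℚ :+ d₁) :* d₁ :* R) :- ((con 1ℚ :+ con 1ℚ) :* ((con 1ℚ :+ d₁) :* α :- con 1ℚ) :* n :* R :- (con 1ℚ :+ d₁) :* d₁ :* R))
        refl d₁ α n R c μ)
      ER
      (cong (_- (X - 1ℚ)) (*-identityʳ μ))

  Y-nonNeg : ∀ d₁ α n R → 0ℚ ≤ R → 0ℚ ≤ n → 1ℚ < (1ℚ + d₁) * α → 0ℚ ≤ ((1ℚ + d₁) * α - 1ℚ) * n * R
  Y-nonNeg d₁ α n R 0≤R 0≤n 1<Dα = 0≤* (0≤* (0≤q-p (<⇒≤ 1<Dα)) 0≤n) 0≤R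

  Y-bounded : ∀ d₁ α n R δ → 0ℚ ≤ R → 0ℚ ≤ n → 1ℚ ≤ d₁ → (1ℚ + d₁) * d₁ * R ≡ 1ℚ → 0ℚ < δ →
    (1ℚ + d₁) * α ≤ two - δ →
    ((1ℚ + d₁) * α - 1ℚ) * n * R + 1ℚ ≤ two + n
  Y-bounded d₁ α n R δ 0≤R 0≤n 1≤d₁ ER 0<δ Dα≤2-δ = 0≤q-p⇒p≤q (subst (0ℚ ≤_) eq nonNeg)
    where
    0≤d₁ : 0ℚ ≤ d₁
    0≤d₁ = ≤-trans 0≤1 1≤d₁
    Dα≤2 : (1ℚ + d₁) * α ≤ two
    Dα≤2 = ≤-trans Dα≤2-δ (0≤q-p⇒p≤q (subst (0ℚ ≤_) (solve 1 (λ δ → δ := (con 1ℚ :+ con 1ℚ) :- ((con 1ℚ :+ con 1ℚ) :- δ)) refl δ) (<⇒≤ 0<δ)))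
    1≤E : 0ℚ ≤ (1ℚ + d₁) * d₁ - 1ℚ
    1≤E = subst (0ℚ ≤_) (solve 1 (λ d₁ → (d₁ :- con 1ℚ) :* (d₁ :+ (con 1ℚ :+ con 1ℚ)) :+ con 1ℚ := (con 1ℚ :+ d₁) :* d₁ :- con 1ℚ) refl d₁)
            (0≤+ (0≤* (0≤q-p 1≤d₁) (0≤+ 0≤d₁ 0≤two)) 0≤1)
    nonNeg : 0ℚ ≤ (two - (1ℚ + d₁) * α) * n * R + n * ((1ℚ + d₁) * d₁ - 1ℚ) * R + (1ℚ + d₁) * d₁ * R
    nonNeg = 0≤+ (0≤+ (0≤* (0≤* (0≤q-p Dα≤2) 0≤n) 0≤R) (0≤* (0≤* 0≤n 1≤E) 0≤R)) (subst (0ℚ ≤_) (sym ER) 0≤1)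
    eq : (two - (1ℚ + d₁) * α) * n * R + n * ((1ℚ + d₁) * d₁ - 1ℚ) * R + (1ℚ + d₁) * d₁ * R
         ≡ two + n - (((1ℚ + d₁) * α - 1ℚ) * n * R + 1ℚ)
    eq = at-ER≡1 (λ z → n * z + z - ((1ℚ + d₁) * α - 1ℚ) * n * R)
      (solve 4 (λ d₁ α n R →
          ((con 1ℚ :+ con 1ℚ) :- (con 1ℚ :+ d₁) :* α) :* n :* R :+ n :* ((con 1ℚ :+ d₁) :* d₁ :- con 1ℚ) :* R :+ (con 1ℚ :+ d₁) :* d₁ :* R
          := n :* ((con 1ℚ :+ d₁) :* d₁ :* R) :+ (con 1ℚ :+ d₁) :* d₁ :* R :- ((con 1ℚ :+ d₁) :* α :- con 1ℚ) :* n :* R) refl d₁ α n R)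
      ER
      (solve 4 (λ d₁ α n R → n :* con 1ℚ :+ con 1ℚ :- ((con 1ℚ :+ d₁) :* α :- con 1ℚ) :* n :* R
          := (con 1ℚ :+ con 1ℚ) :+ n :- (((con 1ℚ :+ d₁) :* α :- con 1ℚ) :* n :* R :+ con 1ℚ)) refl d₁ α n R)

  crossing : ∀ q → ¬ (q ≤ toℚ 0) → ∀ k → q ≤ toℚ k → ∃ λ j → q ≤ toℚ (suc j) × ¬ (q ≤ toℚ j)
  crossing q q≰0 zero    q≤0 = ⊥-elim (q≰0 q≤0)
  crossing q q≰0 (suc k) q≤k with q ≤? toℚ k
  ... | yes q≤k' = crossing q q≰0 k q≤k'
  ... | no  q≰k' = k , q≤k , q≰k'

  choose-s : ∀ Y → 0ℚ ≤ Y → ∀ b → Y + 1ℚ ≤ toℚ b → ∃ λ s₁ → Y + 1ℚ ≤ toℚ (suc s₁) × toℚ (suc s₁) ≤ Y + two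
  choose-s Y 0≤Y b Y+1≤b with crossing (Y + 1ℚ) Y+1≰0 b Y+1≤b
    where
    Y+1≰0 : ¬ (Y + 1ℚ ≤ toℚ 0)
    Y+1≰0 le = <-irrefl refl (<-≤-trans (subst (_< Y + 1ℚ) (+-identityˡ 0ℚ) (+-mono-≤-< 0≤Y 0<1)) le)
  ... | s₁ , Y+1≤s , Y+1≰s₁ = s₁ , Y+1≤s , <⇒≤ (subst₂ _<_ (sym (toℚ-+ 1 s₁)) eq (+-monoʳ-< 1ℚ (≰⇒> Y+1≰s₁)))
    where
    eq : 1ℚ + (Y + 1ℚ) ≡ Y + two
    eq = solve 1 (λ Y → con 1ℚ :+ (Y :+ con 1ℚ) := Y :+ (con 1ℚ :+ con 1ℚ)) refl Y

  -- Density: if Y + 1 ≤ s and N < (m+1) D, then αN ≤ m + (D-1)s, so the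
  -- block set with m full blocks and K = (D-1)s marks is admissible.
  dense-enough : ∀ d₁ α n R m s → 1ℚ ≤ d₁ → (1ℚ + d₁) * d₁ * R ≡ 1ℚ →
    ((1ℚ + d₁) * α - 1ℚ) * n * R + 1ℚ ≤ s →
    1ℚ + n ≤ (1ℚ + m) * (1ℚ + d₁) →
    α * n ≤ m + d₁ * s
  dense-enough d₁ α n R m s 1≤d₁ ER Y+1≤s blocks = 0≤q-p⇒p≤q (cancel-pos-≤ (1+d₁-pos 1≤d₁) (subst (0ℚ ≤_) eq nonNeg))
    where
    0≤d₁ : 0ℚ ≤ d₁
    0≤d₁ = ≤-trans 0≤1 1≤d₁
    Y : ℚ
    Y = ((1ℚ + d₁) * α - 1ℚ) * n * R
    nonNeg : 0ℚ ≤ ((1ℚ + m) * (1ℚ + d₁) - (1ℚ + n)) + (1ℚ + d₁) * d₁ * (s - (Y + 1ℚ)) + d₁ * d₁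
    nonNeg = 0≤+ (0≤+ (0≤q-p blocks) (0≤* (0≤* (0≤+ 0≤1 0≤d₁) 0≤d₁) (0≤q-p Y+1≤s))) (0≤* 0≤d₁ 0≤d₁)
    eq : ((1ℚ + m) * (1ℚ + d₁) - (1ℚ + n)) + (1ℚ + d₁) * d₁ * (s - (Y + 1ℚ)) + d₁ * d₁
         ≡ (1ℚ + d₁) * (m + d₁ * s - α * n)
    eq = at-ER≡1 (λ z → (1ℚ + d₁) * (m + d₁ * s - α * n) + ((1ℚ + d₁) * α - 1ℚ) * n * (1ℚ - z))
      (solve 6 (λ d₁ α n R m s →
          ((con 1ℚ :+ m) :* (con 1ℚ :+ d₁) :- (con 1ℚ :+ n)) :+ (con 1ℚ :+ d₁) :* d₁ :* (s :- (((con 1ℚ :+ d₁) :* α :- con 1ℚ) :* n :* R :+ con 1ℚ)) :+ d₁ :* d₁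
          := (con 1ℚ :+ d₁) :* (m :+ d₁ :* s :- α :* n) :+ ((con 1ℚ :+ d₁) :* α :- con 1ℚ) :* n :* (con 1ℚ :- (con 1ℚ :+ d₁) :* d₁ :* R))
        refl d₁ α n R m s)
      ER
      (solve 4 (λ d₁ α n t → t :+ ((con 1ℚ :+ d₁) :* α :- con 1ℚ) :* n :* (con 1ℚ :- con 1ℚ) := t) refl d₁ α n ((1ℚ + d₁) * (m + d₁ * s - α * n)))

  -- Fitting: if s ≤ Y + 2, N < (m+1) D, Dα ≤ 2 - δ and 2D³ ≤ N(Dδ - 1), then
  -- the K = (D-1)s marked blocks fit among the m full blocks: (D-1)s < m + 1.
  blocks-fit : ∀ d₁ α n R m s δ → 0ℚ ≤ n → 1ℚ ≤ d₁ → (1ℚ + d₁) * d₁ * R ≡ 1ℚ →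
    s ≤ ((1ℚ + d₁) * α - 1ℚ) * n * R + two →
    1ℚ + n ≤ (1ℚ + m) * (1ℚ + d₁) →
    (1ℚ + d₁) * α ≤ two - δ →
    two * ((1ℚ + d₁) * ((1ℚ + d₁) * ((1ℚ + d₁) * 1ℚ))) ≤ n * ((1ℚ + d₁) * δ - 1ℚ) →
    d₁ * s < 1ℚ + m
  blocks-fit d₁ α n R m s δ 0≤n 1≤d₁ ER s≤Y+2 blocks Dα≤2-δ N-large =
    0<q-p⇒p<q (cancel-pos-< (1+d₁-pos 1≤d₁) (subst (0ℚ <_) eq (subst (_< S + 1ℚ) (+-identityʳ 0ℚ) (+-mono-≤-< 0≤S 0<1))))
    where
    0≤d₁ : 0ℚ ≤ d₁
    0≤d₁ = ≤-trans 0≤1 1≤d₁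
    D Y : ℚ
    D = 1ℚ + d₁
    Y = (D * α - 1ℚ) * n * R
    -- 2D³ ≤ N(Dδ - 1) gives δN ≥ 2D².
    2D²≤δn : 0ℚ ≤ δ * n - two * D * D
    2D²≤δn = cancel-pos-≤ (1+d₁-pos 1≤d₁) (subst (0ℚ ≤_)
       (solve 3 (λ d₁ δ n → (n :* ((con 1ℚ :+ d₁) :* δ :- con 1ℚ) :- (con 1ℚ :+ con 1ℚ) :* ((con 1ℚ :+ d₁) :* ((con 1ℚ :+ d₁) :* ((con 1ℚ :+ d₁) :* con 1ℚ)))) :+ n
          := (con 1ℚ :+ d₁) :* (δ :* n :- (con 1ℚ :+ con 1ℚ) :* (con 1ℚ :+ d₁) :* (con 1ℚ :+ d₁))) refl d₁ δ n)
       (0≤+ (0≤q-p N-large) 0≤n))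
    S : ℚ
    S = ((1ℚ + m) * D - (1ℚ + n)) + D * d₁ * ((Y + two) - s) + ((two - δ) - D * α) * n + (δ * n - two * D * D) + two * D
    0≤S : 0ℚ ≤ S
    0≤S = 0≤+ (0≤+ (0≤+ (0≤+ (0≤q-p blocks) (0≤* (0≤* (0≤+ 0≤1 0≤d₁) 0≤d₁) (0≤q-p s≤Y+2))) (0≤* (0≤q-p Dα≤2-δ) 0≤n)) 2D²≤δn) (0≤* 0≤two (0≤+ 0≤1 0≤d₁))
    eq : S + 1ℚ ≡ D * (1ℚ + m - d₁ * s)
    eq = at-ER≡1 (λ z → D * (1ℚ + m - d₁ * s) - (D * α - 1ℚ) * n * (1ℚ - z))
      (solve 7 (λ d₁ α n R m s δ →
          ((con 1ℚ :+ m) :* (con 1ℚ :+ d₁) :- (con 1ℚ :+ n)) :+ (con 1ℚ :+ d₁) :* d₁ :* ((((con 1ℚ :+ d₁) :* α :- con 1ℚ) :* n :* R :+ (con 1ℚ :+ con 1ℚ)) :- s)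
          :+ (((con 1ℚ :+ con 1ℚ) :- δ) :- (con 1ℚ :+ d₁) :* α) :* n :+ (δ :* n :- (con 1ℚ :+ con 1ℚ) :* (con 1ℚ :+ d₁) :* (con 1ℚ :+ d₁))
          :+ (con 1ℚ :+ con 1ℚ) :* (con 1ℚ :+ d₁) :+ con 1ℚ
          := (con 1ℚ :+ d₁) :* (con 1ℚ :+ m :- d₁ :* s) :- ((con 1ℚ :+ d₁) :* α :- con 1ℚ) :* n :* (con 1ℚ :- (con 1ℚ :+ d₁) :* d₁ :* R))
        refl d₁ α n R m s δ)
      ER
      (solve 4 (λ d₁ α n t → t :- ((con 1ℚ :+ d₁) :* α :- con 1ℚ) :* n :* (con 1ℚ :- con 1ℚ) := t) refl d₁ α n (D * (1ℚ + m - d₁ * s)))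

  sandwich : ∀ X Y f s → X ≡ two * Y → X - 1ℚ ≤ f → f ≤ s + s → s ≤ Y + two → ∣ f - X ∣ ≤ two + two
  sandwich X Y f s X≡2Y X-1≤f f≤2s s≤Y+2 with ∣p∣≡p∨∣p∣≡-p (f - X)
  ... | inj₁ ∣f-X∣≡f-X = subst (_≤ two + two) (sym ∣f-X∣≡f-X)
                           (0≤q-p⇒p≤q (subst (0ℚ ≤_) eq (0≤+ (0≤q-p f≤2s) (0≤+ (0≤q-p s≤Y+2) (0≤q-p s≤Y+2)))))
    where
    eq : (s + s - f) + ((Y + two - s) + (Y + two - s)) ≡ two + two - (f - X)
    eq = trans (solve 3 (λ Y f s → (s :+ s :- f) :+ ((Y :+ (con 1ℚ :+ con 1ℚ) :- s) :+ (Y :+ (con 1ℚ :+ con 1ℚ) :- s))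
                := (con 1ℚ :+ con 1ℚ) :+ (con 1ℚ :+ con 1ℚ) :- (f :- (con 1ℚ :+ con 1ℚ) :* Y)) refl Y f s)
               (cong (λ w → two + two - (f - w)) (sym X≡2Y))
  ... | inj₂ ∣f-X∣≡X-f = subst (_≤ two + two) (sym ∣f-X∣≡X-f)
                           (0≤q-p⇒p≤q (subst (0ℚ ≤_) eq (0≤+ (0≤q-p X-1≤f) (0≤+ 0≤two 0≤1))))
    where
    eq : (f - (X - 1ℚ)) + (two + 1ℚ) ≡ two + two - (- (f - X))
    eq = solve 2 (λ X f → (f :- (X :- con 1ℚ)) :+ ((con 1ℚ :+ con 1ℚ) :+ con 1ℚ) := (con 1ℚ :+ con 1ℚ) :+ (con 1ℚ :+ con 1ℚ) :- (:- (f :- X))) refl X f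

module Estimate (D₂ N : ℕ) (α δ : ℚ) where

  open Counting using (f-≤; f-attained)
  open LowerBound using (lower-bound)
  open RationalArithmetic
  open import Defs using (toℚ; recip; f; M)
  import Data.Nat as ℕ
  import Data.Nat.Properties as ℕP
  open import Data.Nat.DivMod using (_/_)
  open import Data.Fin.Subset using (Subset; ⊤; ∣_∣)
  open import Data.Fin.Subset.Properties using (∣⊤∣≡n)
  open import Data.Rational using (0ℚ; 1ℚ; _<_; _≤_; _+_; _*_; _-_)
  import Data.Rational as ℚ
  open import Data.Rational.Properties using (≤-trans; <⇒≤; *-identityˡ; *-monoʳ-≤-nonNeg; *-assoc)
  open import Data.Product using (∃; _×_; _,_; proj₁; proj₂)
  open import Data.Sum using ([_,_]′)
  open import Relation.Binary.PropositionalEquality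

  D₁ D : ℕ
  D₁ = ℕ.suc D₂
  D = ℕ.suc D₁

  d₁ n R Y X : ℚ
  d₁ = toℚ D₁
  n = toℚ N
  R = recip (D ℕ.* D₁)
  Y = ((1ℚ + d₁) * α - 1ℚ) * n * R
  X = two * ((1ℚ + d₁) * α - 1ℚ) * n * R

  toℚ-D : toℚ D ≡ 1ℚ + d₁
  toℚ-D = toℚ-+ 1 D₁

  1≤d₁ : 1ℚ ≤ d₁
  1≤d₁ = toℚ-mono-≤ {1} {D₁} (ℕ.s≤s ℕ.z≤n)

  0≤n : 0ℚ ≤ n
  0≤n = toℚ-mono-≤ {0} {N} ℕ.z≤n

  0≤R : 0ℚ ≤ R
  0≤R = recip-nonNeg (D ℕ.* D₁)

  ER : (1ℚ + d₁) * d₁ * R ≡ 1ℚ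
  ER = trans (cong (_* R) (trans (cong (_* d₁) (sym toℚ-D)) (sym (toℚ-* D D₁)))) (recip-inverse (D ℕ.* D₁))

  X≡2Y : X ≡ two * Y
  X≡2Y = trans (*-assoc (two * ((1ℚ + d₁) * α - 1ℚ)) n R)
           (trans (*-assoc two ((1ℚ + d₁) * α - 1ℚ) (n * R)) (cong (two *_) (sym (*-assoc ((1ℚ + d₁) * α - 1ℚ) n R))))

  lower-admissible : ∀ (A : Subset N) → α * n ≤ toℚ ∣ A ∣ → X - 1ℚ ≤ toℚ (M D A)
  lower-admissible A adm = lower-estimate d₁ α n R (toℚ ∣ A ∣) (toℚ (M D A)) 0≤R 1≤d₁ ER adm
                             (subst₂ _≤_ lhs rhs (toℚ-mono-≤ (lower-bound D A)))
    where
    lhs : toℚ (2 ℕ.* (D ℕ.* ∣ A ∣)) ≡ two * ((1ℚ + d₁) * toℚ ∣ A ∣)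
    lhs = trans (toℚ-* 2 (D ℕ.* ∣ A ∣)) (cong (two *_) (trans (toℚ-* D ∣ A ∣) (cong (_* toℚ ∣ A ∣) toℚ-D)))
    rhs : toℚ (M D A ℕ.* (D₁ ℕ.* D) ℕ.+ 2 ℕ.* N ℕ.+ 2 ℕ.* D₁) ≡ toℚ (M D A) * (d₁ * (1ℚ + d₁)) + two * n + two * d₁
    rhs = trans (toℚ-+ (M D A ℕ.* (D₁ ℕ.* D) ℕ.+ 2 ℕ.* N) (2 ℕ.* D₁))
            (cong₂ _+_ (trans (toℚ-+ (M D A ℕ.* (D₁ ℕ.* D)) (2 ℕ.* N))
                          (cong₂ _+_ (trans (toℚ-* (M D A) (D₁ ℕ.* D)) (cong (toℚ (M D A) *_) (trans (toℚ-* D₁ D) (cong (d₁ *_) toℚ-D))))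
                                     (toℚ-* 2 N)))
                       (toℚ-* 2 D₁))

  f-lower : α < 1ℚ → X - 1ℚ ≤ toℚ (f D N α)
  f-lower α<1 = [_,_]′ (λ f≡M⊤ → subst (λ v → X - 1ℚ ≤ toℚ v) (sym f≡M⊤) (lower-admissible ⊤ ⊤-admissible))
                       (λ (A , adm , f≡MA) → subst (λ v → X - 1ℚ ≤ toℚ v) (sym f≡MA) (lower-admissible A adm))
                       (f-attained D N α)
    where
    ⊤-admissible : α * n ≤ toℚ ∣ ⊤ {N} ∣
    ⊤-admissible = subst (λ z → α * n ≤ toℚ z) (sym (∣⊤∣≡n N))
                     (subst (α * n ≤_) (*-identityˡ n) (*-monoʳ-≤-nonNeg n {{ℚ.nonNegative 0≤n}} (<⇒≤ α<1)))

  f-upper : ∀ s₁ → Y + 1ℚ ≤ toℚ (ℕ.suc s₁) → toℚ (ℕ.suc s₁) ≤ Y + two →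
            toℚ D * α ≤ two - δ → two * toℚ (D ℕ.^ 3) ≤ n * (toℚ D * δ - 1ℚ) →
            f D N α ℕ.≤ ℕ.suc s₁ ℕ.+ ℕ.suc s₁
  f-upper s₁ Y+1≤s s≤Y+2 Dα≤2-δ N-large = ℕP.≤-trans (f-≤ D N α (blockSet N) admissible) (M-bound N)
    where
    open BlockSet D₁ s₁ using (blockSet; M-bound; card-bound; N<blocks; s; K)
    m : ℕ
    m = N / D
    blocks : 1ℚ + n ≤ (1ℚ + toℚ m) * (1ℚ + d₁)
    blocks = subst₂ _≤_ (toℚ-+ 1 N) (trans (toℚ-* (ℕ.suc m) D) (cong₂ _*_ (toℚ-+ 1 m) toℚ-D)) (toℚ-mono-≤ (N<blocks N))
    D³ : toℚ (D ℕ.^ 3) ≡ (1ℚ + d₁) * ((1ℚ + d₁) * ((1ℚ + d₁) * 1ℚ))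
    D³ = trans (toℚ-* D (D ℕ.* (D ℕ.* 1))) (trans (cong (toℚ D *_) (trans (toℚ-* D (D ℕ.* 1)) (cong (toℚ D *_) (toℚ-* D 1))))
           (cong (λ w → w * (w * (w * 1ℚ))) toℚ-D))
    K≤m : K ℕ.≤ m
    K≤m = ℕP.≤-pred (toℚ-cancel-< (subst₂ _<_ (sym (toℚ-* D₁ s)) (sym (toℚ-+ 1 m))
            (blocks-fit d₁ α n R (toℚ m) (toℚ s) δ 0≤n 1≤d₁ ER s≤Y+2 blocks
               (subst (λ w → w * α ≤ two - δ) toℚ-D Dα≤2-δ)
               (subst₂ (λ u w → two * u ≤ n * (w * δ - 1ℚ)) D³ toℚ-D N-large))))
    admissible : α * n ≤ toℚ ∣ blockSet N ∣
    admissible = ≤-trans (subst (α * n ≤_) (trans (cong (toℚ m +_) (sym (toℚ-* D₁ s))) (sym (toℚ-+ m K)))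
                            (dense-enough d₁ α n R (toℚ m) (toℚ s) 1≤d₁ ER Y+1≤s blocks))
                         (toℚ-mono-≤ (card-bound N K≤m))

  estimate : α < 1ℚ → 0ℚ < δ → 1ℚ < toℚ D * α → toℚ D * α ≤ two - δ →
             two * toℚ (D ℕ.^ 3) ≤ n * (toℚ D * δ - 1ℚ) →
             ℚ.∣ toℚ (f D N α) - two * (toℚ D * α - 1ℚ) * n * R ∣ ≤ two + two
  estimate α<1 0<δ 1<Dα Dα≤2-δ N-large = subst (λ w → ℚ.∣ toℚ (f D N α) - two * (w * α - 1ℚ) * n * R ∣ ≤ two + two) (sym toℚ-D)
    (sandwich X Y (toℚ (f D N α)) (toℚ s) X≡2Y (f-lower α<1)
      (subst (toℚ (f D N α) ≤_) (toℚ-+ s s) (toℚ-mono-≤ (f-upper s₁ Y+1≤s s≤Y+2 Dα≤2-δ N-large))) s≤Y+2)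
    where
    Y+1≤2+N : Y + 1ℚ ≤ toℚ (2 ℕ.+ N)
    Y+1≤2+N = subst (Y + 1ℚ ≤_) (sym (toℚ-+ 2 N))
                (Y-bounded d₁ α n R δ 0≤R 0≤n 1≤d₁ ER 0<δ (subst (λ w → w * α ≤ two - δ) toℚ-D Dα≤2-δ))
    choice : ∃ λ s₁ → Y + 1ℚ ≤ toℚ (ℕ.suc s₁) × toℚ (ℕ.suc s₁) ≤ Y + two
    choice = choose-s Y (Y-nonNeg d₁ α n R 0≤R 0≤n (subst (λ w → 1ℚ < w * α) toℚ-D 1<Dα)) (2 ℕ.+ N) Y+1≤2+N
    s₁ s : ℕ
    s₁ = proj₁ choice
    s = ℕ.suc s₁
    Y+1≤s : Y + 1ℚ ≤ toℚ s
    Y+1≤s = proj₁ (proj₂ choice)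
    s≤Y+2 : toℚ s ≤ Y + two
    s≤Y+2 = proj₂ (proj₂ choice)

open import Defs
open import Data.Nat as ℕ using (ℕ; _^_)
open import Data.Product using (∃; _×_; _,_)
open import Data.Rational using (ℚ; 0ℚ; 1ℚ; _<_; _≤_; _+_; _*_; _-_; ∣_∣)

-- D ≤ 1 contradicts α < 1 < Dα; for D ≥ 2 the constant 4 works.
theorem2p1 : ∃ λ (C : ℚ) → ∀ (D N : ℕ) (α δ : ℚ) →
    0ℚ < toℚ D → 0ℚ < toℚ N →
    0ℚ < α → α < 1ℚ → 0ℚ < δ → δ < 1ℚ → 1ℚ < toℚ D * δ →
    1ℚ < toℚ D * α → toℚ D * α ≤ (1ℚ + 1ℚ) - δ →
    (1ℚ + 1ℚ) * toℚ (D ^ 3) ≤ toℚ N * (toℚ D * δ - 1ℚ) →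
    ∣ toℚ (f D N α) - (1ℚ + 1ℚ) * (toℚ D * α - 1ℚ) * toℚ N * recip (D ℕ.* (D ℕ.∸ 1)) ∣ ≤ C
theorem2p1 = two + two , bound
  where
  open RationalArithmetic using (two; 0<1)
  open import Data.Rational.Properties using (<-asym; *-zeroˡ; *-identityˡ)
  open import Relation.Binary.PropositionalEquality using (subst; sym)
  open import Data.Empty using (⊥-elim)
  bound : ∀ (D N : ℕ) (α δ : ℚ) →
    0ℚ < toℚ D → 0ℚ < toℚ N →
    0ℚ < α → α < 1ℚ → 0ℚ < δ → δ < 1ℚ → 1ℚ < toℚ D * δ →
    1ℚ < toℚ D * α → toℚ D * α ≤ two - δ →
    two * toℚ (D ^ 3) ≤ toℚ N * (toℚ D * δ - 1ℚ) →
    ∣ toℚ (f D N α) - two * (toℚ D * α - 1ℚ) * toℚ N * recip (D ℕ.* (D ℕ.∸ 1)) ∣ ≤ two + two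
  bound 0 N α δ _ _ _ _ _ _ _ 1<0α _ _ =
    ⊥-elim (<-asym 1<0α (subst (_< 1ℚ) (sym (*-zeroˡ α)) 0<1))
  bound 1 N α δ _ _ _ α<1 _ _ _ 1<α _ _ =
    ⊥-elim (<-asym α<1 (subst (1ℚ <_) (*-identityˡ α) 1<α))
  bound (ℕ.suc (ℕ.suc D₂)) N α δ _ _ _ α<1 0<δ _ _ 1<Dα Dα≤2-δ N-large =
    Estimate.estimate D₂ N α δ α<1 0<δ 1<Dα Dα≤2-δ N-large
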